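{- Let $S$ be a subdivided star or the empty graph. Then in the game $\mathbf{0.33}$, $\mathcal{G}(S\overset{2}{ - }\emptyset)=\mathcal{G}(S\overset{2}{ - }S_{1,1})$.
   Context: The game $\mathbf{0.33}$ on a finite graph $G$: players alternate; a move chooses a set $X$ of one vertex or of two adjacent vertices of $G$, lying in a connected component $H$ of $G$, such that $H-X$ is empty or connected, and deletes $X$. A player unable to move loses (normal play). Grundy value: $\mathcal{G}(G)=\mathrm{mex}\{\mathcal{G}(G'): G' \text{ reachable in one move}\}$. Subdivided star $S_{\ell_1,\ldots,\ell_k}$: a central vertex $c$ with $k$ vertex-disjoint paths of $\ell_1,\ldots,\ell_k$ vertices each having one endpoint adjacent to $c$; $S_{1,1}=P_3$ with its middle vertex as center. For subdivided stars $S,S'$ with centers $c,c'$, $S\overset{2}{ - }S'$ is the disjoint union of $S$ and $S'$ plus a new vertex $v$ adjacent to $c$ and $c'$. $S\overset{2}{ - }\emptyset$ is $S$ plus a new vertex adjacent only to $c$; if $S$ is empty, $\emptyset\overset{2}{ - }\emptyset=P_1$ and $\emptyset\overset{2}{ - }S'$ is $S'$ plus a new vertex adjacent to $c'$. -}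

module Defs where

open import Data.Bool using (Bool; true; false; _∧_; _∨_; not; if_then_else_)
open import Data.Nat using (ℕ; zero; suc; _+_; _≡ᵇ_; _≤_)
open import Data.Fin using (Fin; toℕ; punchIn)
open import Data.Vec using (Vec; tabulate; lookup)
open import Data.List using (List; []; _∷_; _++_; map; filter; length; allFin; concatMap)
open import Data.Bool.ListAction using (any; all)
open import Data.Nat.ListAction using (sum)
open import Data.Product using (Σ; _×_; _,_; proj₁; proj₂)
open import Data.Maybe using (Maybe; just; nothing)
open import Data.List.Relation.Unary.All using (All)
open import Relation.Binary.PropositionalEquality using (_≡_)

-- Finite (simple, undirected) graphs on vertex set Fin n, given by a
-- Boolean adjacency function.  All graphs built below are symmetric and
-- loopless.

record Graph (n : ℕ) : Set where
  constructor mkGraph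
  field adj : Fin n → Fin n → Bool
open Graph public

del : ∀ {n} → Fin (suc n) → Graph (suc n) → Graph n
del i G = mkGraph (λ a b → adj G (punchIn i a) (punchIn i b))

step : ∀ {n} → Graph n → Vec Bool n → Vec Bool n
step G s = tabulate (λ v → lookup s v ∨ any (λ w → lookup s w ∧ adj G w v) (allFin _))

iter : ∀ {n} → Graph n → ℕ → Vec Bool n → Vec Bool n
iter G zero    s = s
iter G (suc k) s = iter G k (step G s)

-- conn G u v : u and v lie in the same connected component of G
-- (v is reachable from u by a walk with at most n edges)
conn : ∀ {n} → Graph n → Fin n → Fin n → Bool
conn {n} G u v = lookup (iter G n (tabulate (λ w → toℕ u ≡ᵇ toℕ w))) v

_⇒ᵇ_ : Bool → Bool → Bool
a ⇒ᵇ b = not a ∨ b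

-- Legality of moves of 0.33.
-- X = {i} : the component H of G containing i must satisfy: H - X is
-- empty or connected.  Vertices of H - X are the vertices of G - X that
-- are connected to i in G; connectivity inside H - X coincides with
-- connectivity in G - X (paths in G - X never leave H).

validSingle : ∀ {n} → Graph (suc n) → Fin (suc n) → Bool
validSingle {n} G i =
  all (λ u → all (λ v →
        (conn G i (punchIn i u) ∧ conn G i (punchIn i v)) ⇒ᵇ conn (del i G) u v)
      (allFin n)) (allFin n)

-- X = {i, i'} with i' = punchIn i j (so j is the index of i' in G - i);
-- i and i' must be adjacent.
validPair : ∀ {m} → Graph (suc (suc m)) → Fin (suc (suc m)) → Fin (suc m) → Bool
validPair {m} G i j =
  adj G i (punchIn i j) ∧
  all (λ u → all (λ v →
        (conn G i (emb u) ∧ conn G i (emb v)) ⇒ᵇ conn (del j (del i G)) u v)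
      (allFin m)) (allFin m)
  where
  emb : Fin m → Fin (suc (suc m))
  emb u = punchIn i (punchIn j u)

_∈ᵇ_ : ℕ → List ℕ → Bool
k ∈ᵇ xs = any (λ x → x ≡ᵇ k) xs

mexFrom : ℕ → ℕ → List ℕ → ℕ
mexFrom zero    k xs = k
mexFrom (suc f) k xs = if k ∈ᵇ xs then mexFrom f (suc k) xs else k

-- least natural number not in xs (at most length xs, so the fuel suffices)
mex : List ℕ → ℕ
mex xs = mexFrom (suc (length xs)) 0 xs

singleOpts : ∀ {n} → (Graph n → ℕ) → Graph (suc n) → List ℕ
singleOpts gr G =
  map (λ i → gr (del i G)) (filter (λ i → Data.Bool.T? (validSingle G i)) (allFin _))
  where import Data.Bool

pairOpts : ∀ {m} → (Graph m → ℕ) → Graph (suc (suc m)) → List ℕ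
pairOpts {m} gr G =
  concatMap (λ i → map (λ j → gr (del j (del i G)))
                       (filter (λ j → Data.Bool.T? (validPair G i j)) (allFin (suc m))))
            (allFin (suc (suc m)))
  where import Data.Bool

grundy : ∀ n → Graph n → ℕ
grundy zero          G = 0
grundy (suc zero)    G = mex (singleOpts (grundy zero) G)
grundy (suc (suc m)) G = mex (singleOpts (grundy (suc m)) G ++ pairOpts (grundy m) G)

Edge : Set
Edge = ℕ × ℕ

fromEdges : ∀ n → List Edge → Graph n
fromEdges n es = mkGraph (λ a b → any (λ e →
  ((proj₁ e ≡ᵇ toℕ a) ∧ (proj₂ e ≡ᵇ toℕ b)) ∨ ((proj₁ e ≡ᵇ toℕ b) ∧ (proj₂ e ≡ᵇ toℕ a))) es)

-- A subdivided star S_{l1,...,lk} is described by the list [l1,...,lk]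
-- of its path lengths (number of vertices per path).
-- Number of vertices: 1 + l1 + ... + lk.
starSize : List ℕ → ℕ
starSize ls = suc (sum ls)

pathEdges : ℕ → ℕ → ℕ → List Edge
pathEdges att start zero    = []
pathEdges att start (suc l) = (att , start) ∷ pathEdges start (suc start) l

armsEdges : ℕ → ℕ → List ℕ → List Edge
armsEdges c next []       = []
armsEdges c next (l ∷ ls) = pathEdges c next l ++ armsEdges c (next + l) ls

starEdges : ℕ → List ℕ → List Edge
starEdges c ls = armsEdges c (suc c) ls

-- A "subdivided star or empty graph": nothing = empty graph.
size? : Maybe (List ℕ) → ℕ
size? nothing   = 0
size? (just ls) = starSize ls

linkEdges : ℕ → Maybe (List ℕ) → List Edge
linkEdges off nothing   = []
linkEdges off (just ls) = (0 , off) ∷ starEdges off ls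

-- S -2- S' : vertex 0 is the new vertex v, S occupies 1 .. |S|, S'
-- occupies |S|+1 .. |S|+|S'|; v is adjacent to the centers present.
-- (With both empty this is P_1.)
join2Size : Maybe (List ℕ) → Maybe (List ℕ) → ℕ
join2Size S S' = suc (size? S + size? S')

join2 : (S S' : Maybe (List ℕ)) → Graph (join2Size S S')
join2 S S' = fromEdges (join2Size S S') (linkEdges 1 S ++ linkEdges (suc (size? S)) S')

grundyJoin2 : Maybe (List ℕ) → Maybe (List ℕ) → ℕ
grundyJoin2 S S' = grundy (join2Size S S') (join2 S S')

data IsStarOrEmpty : Maybe (List ℕ) → Set where
  empty : IsStarOrEmpty nothing
  star  : ∀ l ls → All (λ x → 1 ≤ x) (l ∷ ls) → IsStarOrEmpty (just (l ∷ ls))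

S11 : Maybe (List ℕ)
S11 = just (1 ∷ 1 ∷ [])

{-# OPTIONS --safe #-}
-- Root every graph at the new vertex v.  A move of 0.33 either avoids v, and then takes place inside
-- one of the pieces glued at v, or deletes v, which is legal only if what remains is connected.  In a
-- subdivided star S the moves avoiding the centre shorten an arm by one or two vertices, so option
-- values can be compared by induction over such shrinks.  First, adding an arm of three vertices at
-- the centre does not change 𝒢(S): the shrinks of S and of the extended star correspond, and no
-- option of the extended star has value 𝒢(S).  Then S -2- ∅ and S -2- S₁,₁ have the same option
-- values: shrinks correspond by induction; deleting v from S -2- ∅ leaves S, worth as much as S with
-- a 3-vertex arm, which is what deleting a leaf of S₁,₁ leaves; every other move is illegal or again
-- a shrink.  The few graphs too small for this are evaluated directly.
module Submission where

open import Defs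
open import Data.Bool using (Bool; true; false; _∧_; _∨_; not; T?; if_then_else_)
open import Data.Bool.Properties using (∨-identityʳ; ∨-assoc; ∨-comm; ∨-zeroʳ; ∧-conicalˡ; ∧-conicalʳ;
  T-≡) renaming (_≟_ to _≟ᵇ_)
open import Data.Bool.ListAction using (any; all; and; or)
open import Data.Empty using (⊥; ⊥-elim)
open import Data.Fin as Fin using (Fin; toℕ; punchIn; fromℕ<)
open import Data.Fin.Properties using (toℕ-injective; toℕ<n; toℕ-fromℕ<; fromℕ<-toℕ; all?; ¬∀⟶∃¬; pigeonhole)
open import Data.List using (List; []; _∷_; map; allFin; filter; length; _++_; concatMap)
import Data.List as L
open import Data.List.Membership.Propositional using (_∈_)
open import Data.List.Membership.Propositional.Properties using (∈-allFin)
open import Data.List.Properties using (map-cong; concatMap-cong)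
open import Data.List.Relation.Unary.All using (All; []; _∷_)
open import Data.List.Relation.Unary.Any as Any using (here; there)
open import Data.List.Relation.Unary.Any.Properties using (lookup-index)
open import Data.Maybe using (Maybe; just; nothing)
open import Data.Nat using (ℕ; zero; suc; _+_; _∸_; _≤_; _<_; z≤n; s≤s; _≡ᵇ_; _<ᵇ_)
open import Data.Nat.Induction using (<-wellFounded)
open import Data.Nat.ListAction using (sum)
open import Data.Nat.Properties
open import Data.Product using (Σ; _×_; _,_; proj₁; proj₂)
open import Data.Sum using (_⊎_; inj₁; inj₂)
open import Data.Vec using (Vec; []; _∷_; lookup; tabulate)
open import Data.Vec.Properties using (lookup∘tabulate; tabulate-cong)
open import Function using (_∘_; id; case_of_)
open import Function.Bundles using (Equivalence)
open import Induction.WellFounded using (module All)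
open import Level using (0ℓ)
import Relation.Binary.Construct.On as On
open import Relation.Binary.Definitions using (tri<; tri≈; tri>)
open import Relation.Binary.PropositionalEquality
open import Relation.Nullary using (Dec; yes; no; ¬_)
open import Relation.Nullary.Decidable using (_→-dec_)

∨-true⁻ : ∀ {a b} → a ∨ b ≡ true → a ≡ true ⊎ b ≡ true
∨-true⁻ {true}  e = inj₁ refl
∨-true⁻ {false} e = inj₂ e

∨-trueˡ : ∀ {a b} → a ≡ true → a ∨ b ≡ true
∨-trueˡ refl = refl

∨-trueʳ : ∀ {a b} → b ≡ true → a ∨ b ≡ true
∨-trueʳ {a} e = trans (cong (a ∨_) e) (∨-zeroʳ a)

≢true⇒false : ∀ {b} → ¬ b ≡ true → b ≡ false
≢true⇒false {true}  h = ⊥-elim (h refl)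
≢true⇒false {false} h = refl

false≢true : ¬ false ≡ true
false≢true ()

true≢false : ¬ true ≡ false
true≢false ()

≡ᵇ-refl : ∀ m → (m ≡ᵇ m) ≡ true
≡ᵇ-refl m = Equivalence.to T-≡ (≡⇒≡ᵇ m m refl)

≡ᵇ⇒≡′ : ∀ {m n} → (m ≡ᵇ n) ≡ true → m ≡ n
≡ᵇ⇒≡′ e = ≡ᵇ⇒≡ _ _ (Equivalence.from T-≡ e)

any⇒∃ : ∀ {A : Set} (p : A → Bool) xs → any p xs ≡ true → Σ A λ x → x ∈ xs × p x ≡ true
any⇒∃ p (x ∷ xs) e with p x in px
... | true  = x , here refl , px
... | false with any⇒∃ p xs e
... | y , y∈xs , py = y , there y∈xs , py

∈⇒any : ∀ {A : Set} (p : A → Bool) xs {x} → x ∈ xs → p x ≡ true → any p xs ≡ true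
∈⇒any p (x ∷ xs) (here refl) px = ∨-trueˡ px
∈⇒any p (y ∷ xs) (there x∈xs) px = ∨-trueʳ {p y} (∈⇒any p xs x∈xs px)

all⇒∀ : ∀ {A : Set} (p : A → Bool) xs → all p xs ≡ true → ∀ x → x ∈ xs → p x ≡ true
all⇒∀ p (y ∷ xs) e x (here refl)  = ∧-conicalˡ _ _ e
all⇒∀ p (y ∷ xs) e x (there x∈xs) = all⇒∀ p xs (∧-conicalʳ (p y) _ e) x x∈xs

∀⇒all : ∀ {A : Set} (p : A → Bool) xs → (∀ x → x ∈ xs → p x ≡ true) → all p xs ≡ true
∀⇒all p []       h = refl
∀⇒all p (y ∷ xs) h = cong₂ _∧_ (h y (here refl)) (∀⇒all p xs (λ x x∈xs → h x (there x∈xs)))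

anyFin⇒∃ : ∀ {n} (p : Fin n → Bool) → any p (allFin n) ≡ true → Σ (Fin n) λ x → p x ≡ true
anyFin⇒∃ {n} p e with any⇒∃ p (allFin n) e
... | x , _ , px = x , px

∃⇒anyFin : ∀ {n} (p : Fin n → Bool) x → p x ≡ true → any p (allFin n) ≡ true
∃⇒anyFin {n} p x = ∈⇒any p (allFin n) (∈-allFin x)

allFin⇒∀ : ∀ {n} (p : Fin n → Bool) → all p (allFin n) ≡ true → ∀ x → p x ≡ true
allFin⇒∀ {n} p e x = all⇒∀ p (allFin n) e x (∈-allFin x)

∀⇒allFin : ∀ {n} (p : Fin n → Bool) → (∀ x → p x ≡ true) → all p (allFin n) ≡ true
∀⇒allFin {n} p h = ∀⇒all p (allFin n) (λ x _ → h x)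

data Reach {n} (G : Graph n) (u : Fin n) : Fin n → Set where
  stay : Reach G u u
  hop  : ∀ {w v} → Reach G u w → adj G w v ≡ true → Reach G u v

_⊆_ : ∀ {n} → Vec Bool n → Vec Bool n → Set
s ⊆ t = ∀ v → lookup s v ≡ true → lookup t v ≡ true

_⊆?_ : ∀ {n} (s t : Vec Bool n) → Dec (s ⊆ t)
s ⊆? t = all? (λ v → (lookup s v ≟ᵇ true) →-dec (lookup t v ≟ᵇ true))

⊈⇒witness : ∀ {n} (s t : Vec Bool n) → ¬ s ⊆ t →
  Σ (Fin n) λ v → lookup s v ≡ true × lookup t v ≡ false
⊈⇒witness {n} s t s⊈t with ¬∀⟶∃¬ n _ (λ v → (lookup s v ≟ᵇ true) →-dec (lookup t v ≟ᵇ true)) s⊈t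
... | v , ¬sv⇒tv with lookup s v in sv | lookup t v in tv
... | true  | true  = ⊥-elim (¬sv⇒tv (λ _ → refl))
... | true  | false = v , sv , tv
... | false | _     = ⊥-elim (¬sv⇒tv (λ ()))

lookup-step : ∀ {n} (G : Graph n) s v →
  lookup (Defs.step G s) v ≡ (lookup s v ∨ any (λ w → lookup s w ∧ adj G w v) (allFin _))
lookup-step G s v = lookup∘tabulate _ v

⊆-step : ∀ {n} (G : Graph n) s → s ⊆ Defs.step G s
⊆-step G s v e = trans (lookup-step G s v) (∨-trueˡ e)

⊆-iter : ∀ {n} (G : Graph n) k s → s ⊆ iter G k s
⊆-iter G zero    s v e = e
⊆-iter G (suc k) s v e = ⊆-iter G k (Defs.step G s) v (⊆-step G s v e)

iter-suc : ∀ {n} (G : Graph n) k s → iter G (suc k) s ≡ Defs.step G (iter G k s)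
iter-suc G zero    s = refl
iter-suc G (suc k) s = iter-suc G k (Defs.step G s)

ReachableFrom : ∀ {n} → Graph n → Fin n → Vec Bool n → Set
ReachableFrom G u s = ∀ w → lookup s w ≡ true → Reach G u w

step-reachable : ∀ {n} (G : Graph n) u s → ReachableFrom G u s → ReachableFrom G u (Defs.step G s)
step-reachable G u s reach v e with ∨-true⁻ (trans (sym (lookup-step G s v)) e)
... | inj₁ sv = reach v sv
... | inj₂ q with anyFin⇒∃ _ q
... | w , r = hop (reach w (∧-conicalˡ _ _ r)) (∧-conicalʳ (lookup s w) _ r)

iter-reachable : ∀ {n} (G : Graph n) u k s → ReachableFrom G u s → ReachableFrom G u (iter G k s)
iter-reachable G u zero    s reach = reach
iter-reachable G u (suc k) s reach = iter-reachable G u k (Defs.step G s) (step-reachable G u s reach)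

singleton : ∀ {n} → Fin n → Vec Bool n
singleton u = tabulate (λ w → toℕ u ≡ᵇ toℕ w)

singleton-self : ∀ {n} (u : Fin n) → lookup (singleton u) u ≡ true
singleton-self u = trans (lookup∘tabulate (λ w → toℕ u ≡ᵇ toℕ w) u) (≡ᵇ-refl (toℕ u))

singleton-reachable : ∀ {n} (G : Graph n) u → ReachableFrom G u (singleton u)
singleton-reachable G u w e =
  subst (Reach G u) (toℕ-injective (≡ᵇ⇒≡′ (trans (sym (lookup∘tabulate (λ w → toℕ u ≡ᵇ toℕ w) w)) e))) stay

conn⇒Reach : ∀ {n} (G : Graph n) u v → conn G u v ≡ true → Reach G u v
conn⇒Reach {n} G u v = iter-reachable G u n (singleton u) (singleton-reachable G u) v

Closed : ∀ {n} → Graph n → Vec Bool n → Set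
Closed G s = ∀ w v → lookup s w ≡ true → adj G w v ≡ true → lookup s v ≡ true

closed⇒step⊆ : ∀ {n} (G : Graph n) s → Closed G s → Defs.step G s ⊆ s
closed⇒step⊆ G s closed v e with ∨-true⁻ (trans (sym (lookup-step G s v)) e)
... | inj₁ sv = sv
... | inj₂ q with anyFin⇒∃ _ q
... | w , r = closed w v (∧-conicalˡ _ _ r) (∧-conicalʳ (lookup s w) _ r)

step⊆⇒closed : ∀ {n} (G : Graph n) s → Defs.step G s ⊆ s → Closed G s
step⊆⇒closed G s step⊆ w v sw a =
  step⊆ v (trans (lookup-step G s v) (∨-trueʳ {lookup s v} (∃⇒anyFin _ w (cong₂ _∧_ sw a))))

step-closed : ∀ {n} (G : Graph n) s → Closed G s → Closed G (Defs.step G s)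
step-closed G s closed w v e a = ⊆-step G s v (closed w v (closed⇒step⊆ G s closed w e) a)

closed-reach : ∀ {n} (G : Graph n) s {u v} → Closed G s → lookup s u ≡ true → Reach G u v → lookup s v ≡ true
closed-reach G s closed su stay      = su
closed-reach G s closed su (hop r a) = closed _ _ (closed-reach G s closed su r) a

#true : ∀ {n} → Vec Bool n → ℕ
#true []          = 0
#true (true ∷ s)  = suc (#true s)
#true (false ∷ s) = #true s

#true≤length : ∀ {n} (s : Vec Bool n) → #true s ≤ n
#true≤length []          = z≤n
#true≤length (true ∷ s)  = s≤s (#true≤length s)
#true≤length (false ∷ s) = m≤n⇒m≤1+n (#true≤length s)

#true-pos : ∀ {n} (s : Vec Bool n) v → lookup s v ≡ true → 1 ≤ #true s
#true-pos (true ∷ s)  v       e = s≤s z≤n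
#true-pos (false ∷ s) (Fin.suc v) e = #true-pos s v e

#true-mono : ∀ {n} (s t : Vec Bool n) → s ⊆ t → #true s ≤ #true t
#true-mono []          []          h = z≤n
#true-mono (true ∷ s)  (true ∷ t)  h = s≤s (#true-mono s t (h ∘ Fin.suc))
#true-mono (true ∷ s)  (false ∷ t) h = ⊥-elim (false≢true (h Fin.zero refl))
#true-mono (false ∷ s) (true ∷ t)  h = m≤n⇒m≤1+n (#true-mono s t (h ∘ Fin.suc))
#true-mono (false ∷ s) (false ∷ t) h = #true-mono s t (h ∘ Fin.suc)

#true-< : ∀ {n} (s t : Vec Bool n) → s ⊆ t → ∀ v → lookup t v ≡ true → lookup s v ≡ false → #true s < #true t
#true-< (false ∷ s) (true ∷ t)  h Fin.zero    tv sv = s≤s (#true-mono s t (h ∘ Fin.suc))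
#true-< (true ∷ s)  (true ∷ t)  h (Fin.suc v) tv sv = s≤s (#true-< s t (h ∘ Fin.suc) v tv sv)
#true-< (true ∷ s)  (false ∷ t) h (Fin.suc v) tv sv = ⊥-elim (false≢true (h Fin.zero refl))
#true-< (false ∷ s) (true ∷ t)  h (Fin.suc v) tv sv = s≤s (#true-mono s t (h ∘ Fin.suc))
#true-< (false ∷ s) (false ∷ t) h (Fin.suc v) tv sv = #true-< s t (h ∘ Fin.suc) v tv sv

-- Each round of closure either marks a new vertex or has reached a closed set; with n vertices
-- at most n - 1 rounds can mark new vertices, so n rounds reach a closed set.
iter-grows-or-closed : ∀ {n} (G : Graph n) s → 1 ≤ #true s → ∀ k →
  suc k ≤ #true (iter G k s) ⊎ Closed G (iter G k s)
iter-grows-or-closed G s nonempty zero = inj₁ nonempty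
iter-grows-or-closed G s nonempty (suc k) rewrite iter-suc G k s
  with iter-grows-or-closed G s nonempty k | Defs.step G (iter G k s) ⊆? iter G k s
... | inj₂ closed | _ = inj₂ (step-closed G (iter G k s) closed)
... | inj₁ _ | yes step⊆ = inj₂ (step-closed G (iter G k s) (step⊆⇒closed G (iter G k s) step⊆))
... | inj₁ grows | no step⊈ with ⊈⇒witness (Defs.step G (iter G k s)) (iter G k s) step⊈
... | v , new , old =
  inj₁ (<-≤-trans (s≤s grows) (#true-< (iter G k s) (Defs.step G (iter G k s)) (⊆-step G (iter G k s)) v new old))

iter-closed : ∀ {n} (G : Graph n) s → 1 ≤ #true s → Closed G (iter G n s)
iter-closed {n} G s nonempty with iter-grows-or-closed G s nonempty n
... | inj₂ closed = closed
... | inj₁ grows  = ⊥-elim (1+n≰n (≤-trans grows (#true≤length (iter G n s))))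

Reach⇒conn : ∀ {n} (G : Graph n) u v → Reach G u v → conn G u v ≡ true
Reach⇒conn {n} G u v =
  closed-reach G (iter G n (singleton u))
    (iter-closed G (singleton u) (#true-pos (singleton u) u (singleton-self u)))
    (⊆-iter G n (singleton u) u (singleton-self u))
∈ᵇ⇒∈ : ∀ k xs → (k ∈ᵇ xs) ≡ true → k ∈ xs
∈ᵇ⇒∈ k xs e with any⇒∃ (λ x → x ≡ᵇ k) xs e
... | x , x∈xs , x≡k = subst (_∈ xs) (≡ᵇ⇒≡′ x≡k) x∈xs

Covers : List ℕ → ℕ → Set
Covers xs k = ∀ j → j < k → (j ∈ᵇ xs) ≡ true

covers-suc : ∀ xs {k} → Covers xs k → (k ∈ᵇ xs) ≡ true → Covers xs (suc k)
covers-suc xs covers k∈xs j (s≤s j≤k) with m≤n⇒m<n∨m≡n j≤k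
... | inj₁ j<k  = covers j j<k
... | inj₂ refl = k∈xs

covers⇒≤length : ∀ xs k → Covers xs k → k ≤ length xs
covers⇒≤length xs k covers = ≮⇒≥ no-room
  where
  occurrence : (j : Fin k) → toℕ j ∈ xs
  occurrence j = ∈ᵇ⇒∈ (toℕ j) xs (covers (toℕ j) (toℕ<n j))
  no-room : ¬ length xs < k
  no-room len<k with pigeonhole len<k (Any.index ∘ occurrence)
  ... | i , j , i<j , same-position = <-irrefl i≡j i<j
    where
    i≡j : toℕ i ≡ toℕ j
    i≡j = trans (lookup-index (occurrence i))
            (trans (cong (L.lookup xs) same-position) (sym (lookup-index (occurrence j))))

mexFrom-spec : ∀ xs f k → Covers xs k →
  Covers xs (mexFrom f k xs) × ((mexFrom f k xs ∈ᵇ xs) ≡ false ⊎ f + k ≤ mexFrom f k xs)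
mexFrom-spec xs zero    k covers = covers , inj₂ ≤-refl
mexFrom-spec xs (suc f) k covers with k ∈ᵇ xs in k∈xs
... | false = covers , inj₁ k∈xs
... | true with mexFrom-spec xs f (suc k) (covers-suc xs covers k∈xs)
...   | covers′ , inj₁ missing   = covers′ , inj₁ missing
...   | covers′ , inj₂ exhausted = covers′ , inj₂ (subst (_≤ mexFrom f (suc k) xs) (+-suc f k) exhausted)

mex-spec : ∀ xs → Covers xs (mex xs) × (mex xs ∈ᵇ xs) ≡ false
mex-spec xs with mexFrom-spec xs (suc (length xs)) 0 (λ j ())
... | covers , inj₁ missing   = covers , missing
... | covers , inj₂ exhausted =
  ⊥-elim (1+n≰n (≤-trans (subst (_≤ mex xs) (+-identityʳ _) exhausted) (covers⇒≤length xs _ covers)))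

mex-unique : ∀ (P : ℕ → Set) m m′ → (∀ k → k < m → P k) → ¬ P m → (∀ k → k < m′ → P k) → ¬ P m′ → m ≡ m′
mex-unique P m m′ below ¬Pm below′ ¬Pm′ with <-cmp m m′
... | tri< m<m′ _ _ = ⊥-elim (¬Pm (below′ m m<m′))
... | tri≈ _ m≡m′ _ = m≡m′
... | tri> _ _ m′<m = ⊥-elim (¬Pm′ (below m′ m′<m))

any-++ : ∀ {A : Set} (p : A → Bool) xs ys → any p (xs ++ ys) ≡ (any p xs ∨ any p ys)
any-++ p []       ys = refl
any-++ p (x ∷ xs) ys = trans (cong (p x ∨_) (any-++ p xs ys)) (sym (∨-assoc (p x) _ _))

∈ᵇ-++⁻ : ∀ k xs ys → (k ∈ᵇ (xs ++ ys)) ≡ true → (k ∈ᵇ xs) ≡ true ⊎ (k ∈ᵇ ys) ≡ true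
∈ᵇ-++⁻ k xs ys e = ∨-true⁻ (trans (sym (any-++ (λ x → x ≡ᵇ k) xs ys)) e)

∈ᵇ-++⁺ˡ : ∀ k xs ys → (k ∈ᵇ xs) ≡ true → (k ∈ᵇ (xs ++ ys)) ≡ true
∈ᵇ-++⁺ˡ k xs ys e = trans (any-++ (λ x → x ≡ᵇ k) xs ys) (∨-trueˡ e)

∈ᵇ-++⁺ʳ : ∀ k xs ys → (k ∈ᵇ ys) ≡ true → (k ∈ᵇ (xs ++ ys)) ≡ true
∈ᵇ-++⁺ʳ k xs ys e = trans (any-++ (λ x → x ≡ᵇ k) xs ys) (∨-trueʳ {k ∈ᵇ xs} e)

∈ᵇ-mapFilter⁻ : ∀ {A : Set} (p : A → Bool) (f : A → ℕ) k xs →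
  (k ∈ᵇ map f (filter (T? ∘ p) xs)) ≡ true → Σ A λ x → p x ≡ true × f x ≡ k
∈ᵇ-mapFilter⁻ p f k (x ∷ xs) e with p x in px
... | false = ∈ᵇ-mapFilter⁻ p f k xs e
... | true with f x ≡ᵇ k in fx≡k
...   | true  = x , px , ≡ᵇ⇒≡′ fx≡k
...   | false = ∈ᵇ-mapFilter⁻ p f k xs e

∈ᵇ-mapFilter⁺ : ∀ {A : Set} (p : A → Bool) (f : A → ℕ) xs x → x ∈ xs → p x ≡ true →
  (f x ∈ᵇ map f (filter (T? ∘ p) xs)) ≡ true
∈ᵇ-mapFilter⁺ p f (y ∷ xs) x (here refl) px rewrite px = ∨-trueˡ (≡ᵇ-refl (f x))
∈ᵇ-mapFilter⁺ p f (y ∷ xs) x (there x∈xs) px with p y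
... | false = ∈ᵇ-mapFilter⁺ p f xs x x∈xs px
... | true  = ∨-trueʳ {f y ≡ᵇ f x} (∈ᵇ-mapFilter⁺ p f xs x x∈xs px)

∈ᵇ-concatMap⁻ : ∀ {A : Set} (g : A → List ℕ) k xs → (k ∈ᵇ concatMap g xs) ≡ true → Σ A λ x → (k ∈ᵇ g x) ≡ true
∈ᵇ-concatMap⁻ g k (x ∷ xs) e with ∈ᵇ-++⁻ k (g x) (concatMap g xs) e
... | inj₁ k∈gx = x , k∈gx
... | inj₂ k∈rest = ∈ᵇ-concatMap⁻ g k xs k∈rest

∈ᵇ-concatMap⁺ : ∀ {A : Set} (g : A → List ℕ) k xs x → x ∈ xs → (k ∈ᵇ g x) ≡ true → (k ∈ᵇ concatMap g xs) ≡ true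
∈ᵇ-concatMap⁺ g k (y ∷ xs) x (here refl)  e = ∈ᵇ-++⁺ˡ k (g x) (concatMap g xs) e
∈ᵇ-concatMap⁺ g k (y ∷ xs) x (there x∈xs) e = ∈ᵇ-++⁺ʳ k (g y) (concatMap g xs) (∈ᵇ-concatMap⁺ g k xs x x∈xs e)

Conn : ∀ {n} → Graph n → Set
Conn G = ∀ u v → Reach G u v

⇒ᵇ-mp : ∀ {a b} → a ≡ true → (a ⇒ᵇ b) ≡ true → b ≡ true
⇒ᵇ-mp refl e = e

-- In a connected graph every vertex lies in the component of the deleted vertices, so the
-- legality tests validSingle and validPair say exactly that what remains is connected.
validSingle⇒Conn : ∀ {n} (G : Graph (suc n)) i → Conn G → validSingle G i ≡ true → Conn (del i G)
validSingle⇒Conn G i connected legal u v =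
  conn⇒Reach (del i G) u v
    (⇒ᵇ-mp (cong₂ _∧_ (Reach⇒conn G i _ (connected _ _)) (Reach⇒conn G i _ (connected _ _)))
           (allFin⇒∀ _ (allFin⇒∀ _ legal u) v))

Conn⇒validSingle : ∀ {n} (G : Graph (suc n)) i → Conn (del i G) → validSingle G i ≡ true
Conn⇒validSingle G i connected =
  ∀⇒allFin _ λ u → ∀⇒allFin _ λ v →
    ∨-trueʳ {not (conn G i (punchIn i u) ∧ conn G i (punchIn i v))} (Reach⇒conn (del i G) u v (connected u v))

validPair⇒ : ∀ {m} (G : Graph (suc (suc m))) i j → Conn G → validPair G i j ≡ true →
  adj G i (punchIn i j) ≡ true × Conn (del j (del i G))
validPair⇒ G i j connected legal = ∧-conicalˡ _ _ legal , λ u v →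
  conn⇒Reach _ u v
    (⇒ᵇ-mp (cong₂ _∧_ (Reach⇒conn G i _ (connected _ _)) (Reach⇒conn G i _ (connected _ _)))
           (allFin⇒∀ _ (allFin⇒∀ _ (∧-conicalʳ (adj G i (punchIn i j)) _ legal) u) v))

⇒validPair : ∀ {m} (G : Graph (suc (suc m))) i j →
  adj G i (punchIn i j) ≡ true → Conn (del j (del i G)) → validPair G i j ≡ true
⇒validPair G i j edge connected = cong₂ _∧_ edge
  (∀⇒allFin _ λ u → ∀⇒allFin _ λ v →
    ∨-trueʳ {not (conn G i (punchIn i (punchIn j u)) ∧ conn G i (punchIn i (punchIn j v)))}
      (Reach⇒conn _ u v (connected u v)))

SingleOptionValueᴳ : ∀ {n} → Graph (suc n) → ℕ → Set
SingleOptionValueᴳ {n} G k = Σ (Fin (suc n)) λ i → Conn (del i G) × grundy n (del i G) ≡ k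

PairOptionValueᴳ : ∀ {n} → Graph (suc n) → ℕ → Set
PairOptionValueᴳ {zero}  G k = ⊥
PairOptionValueᴳ {suc m} G k = Σ (Fin (suc (suc m))) λ i → Σ (Fin (suc m)) λ j →
  adj G i (punchIn i j) ≡ true × Conn (del j (del i G)) × grundy m (del j (del i G)) ≡ k

-- For connected G these are exactly the values of the legal moves of 0.33.
OptionValueᴳ : ∀ {n} → Graph (suc n) → ℕ → Set
OptionValueᴳ G k = SingleOptionValueᴳ G k ⊎ PairOptionValueᴳ G k

optionValues : ∀ {n} → Graph (suc n) → List ℕ
optionValues {zero}  G = singleOpts (grundy zero) G
optionValues {suc m} G = singleOpts (grundy (suc m)) G ++ pairOpts (grundy m) G

grundy≡mex : ∀ {n} (G : Graph (suc n)) → grundy (suc n) G ≡ mex (optionValues G)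
grundy≡mex {zero}  G = refl
grundy≡mex {suc n} G = refl

∈singleOpts⇒ : ∀ {n} (G : Graph (suc n)) k → Conn G → (k ∈ᵇ singleOpts (grundy n) G) ≡ true →
  SingleOptionValueᴳ G k
∈singleOpts⇒ G k connected e with ∈ᵇ-mapFilter⁻ (validSingle G) (λ i → grundy _ (del i G)) k (allFin _) e
... | i , legal , value = i , validSingle⇒Conn G i connected legal , value

⇒∈singleOpts : ∀ {n} (G : Graph (suc n)) i → Conn (del i G) →
  (grundy n (del i G) ∈ᵇ singleOpts (grundy n) G) ≡ true
⇒∈singleOpts G i connected =
  ∈ᵇ-mapFilter⁺ (validSingle G) (λ i → grundy _ (del i G)) (allFin _) i (∈-allFin i)
    (Conn⇒validSingle G i connected)

∈pairOpts⇒ : ∀ {m} (G : Graph (suc (suc m))) k → Conn G → (k ∈ᵇ pairOpts (grundy m) G) ≡ true →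
  PairOptionValueᴳ G k
∈pairOpts⇒ {m} G k connected e
  with ∈ᵇ-concatMap⁻ (λ i → map (λ j → grundy m (del j (del i G))) (filter (T? ∘ validPair G i) (allFin (suc m))))
                     k (allFin _) e
... | i , e′ with ∈ᵇ-mapFilter⁻ (validPair G i) (λ j → grundy m (del j (del i G))) k (allFin _) e′
... | j , legal , value with validPair⇒ G i j connected legal
...   | edge , connected′ = i , j , edge , connected′ , value

⇒∈pairOpts : ∀ {m} (G : Graph (suc (suc m))) i j → adj G i (punchIn i j) ≡ true → Conn (del j (del i G)) →
  (grundy m (del j (del i G)) ∈ᵇ pairOpts (grundy m) G) ≡ true
⇒∈pairOpts {m} G i j edge connected =
  ∈ᵇ-concatMap⁺ (λ i → map (λ j → grundy m (del j (del i G))) (filter (T? ∘ validPair G i) (allFin (suc m))))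
    _ (allFin _) i (∈-allFin i)
    (∈ᵇ-mapFilter⁺ (validPair G i) (λ j → grundy m (del j (del i G))) (allFin _) j (∈-allFin j)
      (⇒validPair G i j edge connected))

∈optionValues⇒ : ∀ {n} (G : Graph (suc n)) k → Conn G → (k ∈ᵇ optionValues G) ≡ true → OptionValueᴳ G k
∈optionValues⇒ {zero}  G k connected e = inj₁ (∈singleOpts⇒ G k connected e)
∈optionValues⇒ {suc m} G k connected e with ∈ᵇ-++⁻ k (singleOpts (grundy (suc m)) G) (pairOpts (grundy m) G) e
... | inj₁ single = inj₁ (∈singleOpts⇒ G k connected single)
... | inj₂ pair   = inj₂ (∈pairOpts⇒ G k connected pair)

⇒∈optionValues : ∀ {n} (G : Graph (suc n)) k → OptionValueᴳ G k → (k ∈ᵇ optionValues G) ≡ true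
⇒∈optionValues {zero}  G k (inj₁ (i , connected , refl)) = ⇒∈singleOpts G i connected
⇒∈optionValues {suc m} G k (inj₁ (i , connected , refl)) =
  ∈ᵇ-++⁺ˡ _ (singleOpts (grundy (suc m)) G) (pairOpts (grundy m) G) (⇒∈singleOpts G i connected)
⇒∈optionValues {suc m} G k (inj₂ (i , j , edge , connected , refl)) =
  ∈ᵇ-++⁺ʳ _ (singleOpts (grundy (suc m)) G) (pairOpts (grundy m) G) (⇒∈pairOpts G i j edge connected)

grundy-below : ∀ {n} (G : Graph (suc n)) → Conn G → ∀ k → k < grundy (suc n) G → OptionValueᴳ G k
grundy-below G connected k k< rewrite grundy≡mex G =
  ∈optionValues⇒ G k connected (proj₁ (mex-spec (optionValues G)) k k<)

grundy-not-option : ∀ {n} (G : Graph (suc n)) → ¬ OptionValueᴳ G (grundy (suc n) G)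
grundy-not-option G option with ⇒∈optionValues G _ option
... | e rewrite grundy≡mex G = true≢false (trans (sym e) (proj₂ (mex-spec (optionValues G))))

SameAdj : ∀ {n} → Graph n → Graph n → Set
SameAdj G H = ∀ a b → adj G a b ≡ adj H a b

any-cong : ∀ {A : Set} (p q : A → Bool) xs → (∀ x → p x ≡ q x) → any p xs ≡ any q xs
any-cong p q xs p≗q = cong or (map-cong p≗q xs)

all-cong : ∀ {A : Set} (p q : A → Bool) xs → (∀ x → p x ≡ q x) → all p xs ≡ all q xs
all-cong p q xs p≗q = cong and (map-cong p≗q xs)

step-cong : ∀ {n} (G H : Graph n) → SameAdj G H → ∀ s → Defs.step G s ≡ Defs.step H s
step-cong G H same s = tabulate-cong λ v →
  cong (lookup s v ∨_) (any-cong _ _ (allFin _) (λ w → cong (lookup s w ∧_) (same w v)))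

iter-cong : ∀ {n} (G H : Graph n) → SameAdj G H → ∀ k s → iter G k s ≡ iter H k s
iter-cong G H same zero    s = refl
iter-cong G H same (suc k) s rewrite step-cong G H same s = iter-cong G H same k (Defs.step H s)

conn-cong : ∀ {n} (G H : Graph n) → SameAdj G H → ∀ u v → conn G u v ≡ conn H u v
conn-cong {n} G H same u v = cong (λ s → lookup s v) (iter-cong G H same n _)

del-cong : ∀ {n} (G H : Graph (suc n)) → SameAdj G H → ∀ i → SameAdj (del i G) (del i H)
del-cong G H same i a b = same _ _

validSingle-cong : ∀ {n} (G H : Graph (suc n)) → SameAdj G H → ∀ i → validSingle G i ≡ validSingle H i
validSingle-cong G H same i = all-cong _ _ (allFin _) λ u → all-cong _ _ (allFin _) λ v →
  cong₂ _⇒ᵇ_ (cong₂ _∧_ (conn-cong G H same i _) (conn-cong G H same i _))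
             (conn-cong _ _ (del-cong G H same i) u v)

validPair-cong : ∀ {m} (G H : Graph (suc (suc m))) → SameAdj G H → ∀ i j → validPair G i j ≡ validPair H i j
validPair-cong G H same i j = cong₂ _∧_ (same _ _) (all-cong _ _ (allFin _) λ u → all-cong _ _ (allFin _) λ v →
  cong₂ _⇒ᵇ_ (cong₂ _∧_ (conn-cong G H same i _) (conn-cong G H same i _))
             (conn-cong _ _ (del-cong _ _ (del-cong G H same i) j) u v))

mapFilter-cong : ∀ {A : Set} (p q : A → Bool) (f g : A → ℕ) xs → (∀ x → p x ≡ q x) → (∀ x → f x ≡ g x) →
  map f (filter (T? ∘ p) xs) ≡ map g (filter (T? ∘ q) xs)
mapFilter-cong p q f g []       p≗q f≗g = refl
mapFilter-cong p q f g (x ∷ xs) p≗q f≗g with p x | q x | p≗q x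
... | false | .false | refl = mapFilter-cong p q f g xs p≗q f≗g
... | true  | .true  | refl = cong₂ _∷_ (f≗g x) (mapFilter-cong p q f g xs p≗q f≗g)

grundy-cong : ∀ n (G H : Graph n) → SameAdj G H → grundy n G ≡ grundy n H
grundy-cong zero          G H same = refl
grundy-cong (suc zero)    G H same = cong mex
  (mapFilter-cong _ _ _ _ (allFin _) (validSingle-cong G H same)
    (λ i → grundy-cong zero _ _ (del-cong G H same i)))
grundy-cong (suc (suc m)) G H same = cong mex (cong₂ _++_
  (mapFilter-cong _ _ _ _ (allFin _) (validSingle-cong G H same)
    (λ i → grundy-cong (suc m) _ _ (del-cong G H same i)))
  (concatMap-cong (λ i → mapFilter-cong _ _ _ _ (allFin _) (validPair-cong G H same i)
                    (λ j → grundy-cong m _ _ (del-cong _ _ (del-cong G H same i) j))) (allFin _)))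

Conn-cong : ∀ {n} (G H : Graph n) → SameAdj G H → Conn G → Conn H
Conn-cong G H same connected u v = transport (connected u v)
  where
  transport : ∀ {u v} → Reach G u v → Reach H u v
  transport stay      = stay
  transport (hop r a) = hop (transport r) (trans (sym (same _ _)) a)

-- Graphs handled by the argument are adjacency functions on ℕ, read on an initial segment.
Adj : Set
Adj = ℕ → ℕ → Bool

toGraph : (n : ℕ) → Adj → Graph n
toGraph n f = mkGraph (λ a b → f (toℕ a) (toℕ b))

punchInℕ : ℕ → ℕ → ℕ
punchInℕ i x = if x <ᵇ i then x else suc x

delete : ℕ → Adj → Adj
delete i f x y = f (punchInℕ i x) (punchInℕ i y)

toℕ-punchIn : ∀ {n} (i : Fin (suc n)) (j : Fin n) → toℕ (punchIn i j) ≡ punchInℕ (toℕ i) (toℕ j)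
toℕ-punchIn Fin.zero    j           = refl
toℕ-punchIn (Fin.suc i) Fin.zero    = refl
toℕ-punchIn (Fin.suc i) (Fin.suc j) with toℕ j <ᵇ toℕ i | toℕ-punchIn i j
... | true  | e = cong suc e
... | false | e = cong suc e

del-toGraph : ∀ n f (i : Fin (suc n)) → SameAdj (del i (toGraph (suc n) f)) (toGraph n (delete (toℕ i) f))
del-toGraph n f i a b = cong₂ f (toℕ-punchIn i a) (toℕ-punchIn i b)

del²-toGraph : ∀ m f (i : Fin (suc (suc m))) (j : Fin (suc m)) →
  SameAdj (del j (del i (toGraph (suc (suc m)) f))) (toGraph m (delete (toℕ j) (delete (toℕ i) f)))
del²-toGraph m f i j a b = trans (del-toGraph (suc m) f i _ _) (del-toGraph m (delete (toℕ i) f) j a b)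

-- Opaque so that Grundy values of concrete graphs are only computed where asked for.
opaque
  𝒢 : ℕ → Adj → ℕ
  𝒢 n f = grundy n (toGraph n f)

Agree : ℕ → Adj → Adj → Set
Agree n f g = ∀ x y → x < n → y < n → f x y ≡ g x y

Agree⇒SameAdj : ∀ n f g → Agree n f g → SameAdj (toGraph n f) (toGraph n g)
Agree⇒SameAdj n f g agree a b = agree _ _ (toℕ<n a) (toℕ<n b)

opaque
  unfolding 𝒢

  𝒢-def : ∀ n f → 𝒢 n f ≡ grundy n (toGraph n f)
  𝒢-def n f = refl

  𝒢-cong : ∀ n f g → Agree n f g → 𝒢 n f ≡ 𝒢 n g
  𝒢-cong n f g agree = grundy-cong n _ _ (Agree⇒SameAdj n f g agree)

𝒢-cong′ : ∀ n n′ f g → n ≡ n′ → Agree n f g → 𝒢 n f ≡ 𝒢 n′ g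
𝒢-cong′ n .n f g refl = 𝒢-cong n f g

data Walk (n : ℕ) (f : Adj) (x : ℕ) : ℕ → Set where
  start : Walk n f x x
  next  : ∀ {w y} → Walk n f x w → y < n → f w y ≡ true → Walk n f x y

walk-trans : ∀ {n f x w y} → Walk n f x w → Walk n f w y → Walk n f x y
walk-trans r start           = r
walk-trans r (next r′ y< e) = next (walk-trans r r′) y< e

walk-edge : ∀ {n f x y} → y < n → f x y ≡ true → Walk n f x y
walk-edge = next start

walk-end< : ∀ {n f x y} → x < n → Walk n f x y → y < n
walk-end< x< start          = x<
walk-end< x< (next _ y< _) = y<

Connected : ℕ → Adj → Set
Connected n f = ∀ x y → x < n → y < n → Walk n f x y

walk⇒Reach : ∀ {n f x y} (x< : x < n) (r : Walk n f x y) →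
  Reach (toGraph n f) (fromℕ< x<) (fromℕ< (walk-end< x< r))
walk⇒Reach x< start = stay
walk⇒Reach {f = f} x< (next r y< e) =
  hop (walk⇒Reach x< r) (trans (cong₂ f (toℕ-fromℕ< (walk-end< x< r)) (toℕ-fromℕ< y<)) e)

Reach⇒walk : ∀ {n f} {u v : Fin n} → Reach (toGraph n f) u v → Walk n f (toℕ u) (toℕ v)
Reach⇒walk stay                = start
Reach⇒walk {v = v} (hop r e) = next (Reach⇒walk r) (toℕ<n v) e

Connected⇒Conn : ∀ n f → Connected n f → Conn (toGraph n f)
Connected⇒Conn n f connected u v =
  subst₂ (Reach (toGraph n f)) (fromℕ<-toℕ u (toℕ<n u)) (fromℕ<-toℕ v (toℕ<n v))
    (walk⇒Reach (toℕ<n u) (connected (toℕ u) (toℕ v) (toℕ<n u) (toℕ<n v)))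

Conn⇒Connected : ∀ n f → Conn (toGraph n f) → Connected n f
Conn⇒Connected n f connected x y x< y< =
  subst₂ (Walk n f) (toℕ-fromℕ< x<) (toℕ-fromℕ< y<) (Reach⇒walk (connected (fromℕ< x<) (fromℕ< y<)))

Connected-cong : ∀ n f g → Agree n f g → Connected n f → Connected n g
Connected-cong n f g agree connected =
  Conn⇒Connected n g (Conn-cong _ _ (Agree⇒SameAdj n f g agree) (Connected⇒Conn n f connected))

SingleOptionValue : ℕ → Adj → ℕ → Set
SingleOptionValue n f k = Σ ℕ λ i → i < suc n × Connected n (delete i f) × 𝒢 n (delete i f) ≡ k

PairOptionValue : ℕ → Adj → ℕ → Set
PairOptionValue zero    f k = ⊥
PairOptionValue (suc m) f k = Σ ℕ λ i → Σ ℕ λ j → i < suc (suc m) × j < suc m × f i (punchInℕ i j) ≡ true ×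
  Connected m (delete j (delete i f)) × 𝒢 m (delete j (delete i f)) ≡ k

OptionValue : ℕ → Adj → ℕ → Set
OptionValue n f k = SingleOptionValue n f k ⊎ PairOptionValue n f k

del-toGraph-fromℕ< : ∀ n f {i} (i< : i < suc n) →
  SameAdj (del (fromℕ< i<) (toGraph (suc n) f)) (toGraph n (delete i f))
del-toGraph-fromℕ< n f i< a b =
  trans (del-toGraph n f (fromℕ< i<) a b) (cong (λ z → delete z f (toℕ a) (toℕ b)) (toℕ-fromℕ< i<))

del²-toGraph-fromℕ< : ∀ m f {i j} (i< : i < suc (suc m)) (j< : j < suc m) →
  SameAdj (del (fromℕ< j<) (del (fromℕ< i<) (toGraph (suc (suc m)) f))) (toGraph m (delete j (delete i f)))
del²-toGraph-fromℕ< m f i< j< a b =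
  trans (del²-toGraph m f (fromℕ< i<) (fromℕ< j<) a b)
    (cong₂ (λ z w → delete w (delete z f) (toℕ a) (toℕ b)) (toℕ-fromℕ< i<) (toℕ-fromℕ< j<))

opaque
  unfolding 𝒢

  OptionValueᴳ⇒OptionValue : ∀ n f k → OptionValueᴳ (toGraph (suc n) f) k → OptionValue n f k
  OptionValueᴳ⇒OptionValue n f k (inj₁ (i , connected , value)) =
    inj₁ (toℕ i , toℕ<n i ,
          Conn⇒Connected n _ (Conn-cong _ _ (del-toGraph n f i) connected) ,
          trans (sym (grundy-cong n _ _ (del-toGraph n f i))) value)
  OptionValueᴳ⇒OptionValue (suc m) f k (inj₂ (i , j , edge , connected , value)) =
    inj₂ (toℕ i , toℕ j , toℕ<n i , toℕ<n j ,
          trans (cong (f (toℕ i)) (sym (toℕ-punchIn i j))) edge ,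
          Conn⇒Connected m _ (Conn-cong _ _ (del²-toGraph m f i j) connected) ,
          trans (sym (grundy-cong m _ _ (del²-toGraph m f i j))) value)

  OptionValue⇒OptionValueᴳ : ∀ n f k → OptionValue n f k → OptionValueᴳ (toGraph (suc n) f) k
  OptionValue⇒OptionValueᴳ n f k (inj₁ (i , i< , connected , value)) =
    inj₁ (fromℕ< i< ,
          Conn-cong _ _ (λ a b → sym (del-toGraph-fromℕ< n f i< a b)) (Connected⇒Conn n _ connected) ,
          trans (grundy-cong n _ _ (del-toGraph-fromℕ< n f i<)) value)
  OptionValue⇒OptionValueᴳ (suc m) f k (inj₂ (i , j , i< , j< , edge , connected , value)) =
    inj₂ (fromℕ< i< , fromℕ< j< ,
          trans (cong₂ f (toℕ-fromℕ< i<)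
                  (trans (toℕ-punchIn (fromℕ< i<) (fromℕ< j<)) (cong₂ punchInℕ (toℕ-fromℕ< i<) (toℕ-fromℕ< j<))))
                edge ,
          Conn-cong _ _ (λ a b → sym (del²-toGraph-fromℕ< m f i< j< a b)) (Connected⇒Conn m _ connected) ,
          trans (grundy-cong m _ _ (del²-toGraph-fromℕ< m f i< j<)) value)

  𝒢-below : ∀ n f → Connected (suc n) f → ∀ k → k < 𝒢 (suc n) f → OptionValue n f k
  𝒢-below n f connected k k< = OptionValueᴳ⇒OptionValue n f k (grundy-below _ (Connected⇒Conn _ f connected) k k<)

  𝒢-not-option : ∀ n f → ¬ OptionValue n f (𝒢 (suc n) f)
  𝒢-not-option n f option = grundy-not-option _ (OptionValue⇒OptionValueᴳ n f _ option)

𝒢-unique : ∀ n f → Connected (suc n) f → ∀ m →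
  (∀ k → k < m → OptionValue n f k) → ¬ OptionValue n f m → 𝒢 (suc n) f ≡ m
𝒢-unique n f connected m below ¬option =
  mex-unique (OptionValue n f) _ m (𝒢-below n f connected) (𝒢-not-option n f) below ¬option

𝒢-cong-options : ∀ n f m g → Connected (suc n) f → Connected (suc m) g →
  (∀ k → OptionValue n f k → OptionValue m g k) → (∀ k → OptionValue m g k → OptionValue n f k) →
  𝒢 (suc n) f ≡ 𝒢 (suc m) g
𝒢-cong-options n f m g connected-f connected-g f⊆g g⊆f =
  sym (𝒢-unique m g connected-g _ (λ k k< → f⊆g k (𝒢-below n f connected-f k k<)) (𝒢-not-option n f ∘ g⊆f _))

option≢𝒢 : ∀ n f k → OptionValue n f k → 𝒢 (suc n) f ≢ k
option≢𝒢 n f k option refl = 𝒢-not-option n f option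

<ᵇ-true : ∀ {x a} → x < a → (x <ᵇ a) ≡ true
<ᵇ-true x<a = Equivalence.to T-≡ (<⇒<ᵇ x<a)

<ᵇ-false : ∀ {x a} → a ≤ x → (x <ᵇ a) ≡ false
<ᵇ-false {x} {a} a≤x = ≢true⇒false λ x<ᵇa → <⇒≱ (<ᵇ⇒< x a (Equivalence.from T-≡ x<ᵇa)) a≤x

<ᵇ-cases : ∀ x a → ((x <ᵇ a) ≡ true × x < a) ⊎ ((x <ᵇ a) ≡ false × a ≤ x)
<ᵇ-cases x a with x <? a
... | yes x<a = inj₁ (<ᵇ-true x<a , x<a)
... | no  x≮a = inj₂ (<ᵇ-false (≮⇒≥ x≮a) , ≮⇒≥ x≮a)

punchInℕ-< : ∀ {i x} → x < i → punchInℕ i x ≡ x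
punchInℕ-< x<i rewrite <ᵇ-true x<i = refl

punchInℕ-≥ : ∀ {i x} → i ≤ x → punchInℕ i x ≡ suc x
punchInℕ-≥ i≤x rewrite <ᵇ-false i≤x = refl

punchInℕ-suc : ∀ i x → punchInℕ (suc i) (suc x) ≡ suc (punchInℕ i x)
punchInℕ-suc i x with x <ᵇ i
... | true  = refl
... | false = refl

punchInℕ-bound : ∀ {i x n} → x < n → punchInℕ i x < suc n
punchInℕ-bound {i} {x} x<n with x <ᵇ i
... | true  = m≤n⇒m≤1+n x<n
... | false = s≤s x<n

Symmetric : Adj → Set
Symmetric f = ∀ x y → f x y ≡ f y x

Loopless : Adj → Set
Loopless f = ∀ x → f x x ≡ false

delete-symmetric : ∀ i f → Symmetric f → Symmetric (delete i f)
delete-symmetric i f symmetric x y = symmetric _ _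

delete-loopless : ∀ i f → Loopless f → Loopless (delete i f)
delete-loopless i f loopless x = loopless _

Agree-sym : ∀ {n f g} → Agree n f g → Agree n g f
Agree-sym agree x y x< y< = sym (agree x y x< y<)

Agree-delete : ∀ {n f g} i → Agree (suc n) f g → Agree n (delete i f) (delete i g)
Agree-delete i agree x y x< y< = agree _ _ (punchInℕ-bound {i} x<) (punchInℕ-bound {i} y<)

pointwise⇒Agree : ∀ {n f g} → (∀ x y → f x y ≡ g x y) → Agree n f g
pointwise⇒Agree f≗g x y _ _ = f≗g x y

walk-preserves : ∀ {n f x y} (C : ℕ → Bool) → (∀ w z → C w ≡ true → f w z ≡ true → C z ≡ true) →
  Walk n f x y → C x ≡ true → C y ≡ true
walk-preserves C closed start        Cx = Cx
walk-preserves C closed (next r _ e) Cx = closed _ _ (walk-preserves C closed r Cx) e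

walk-reverse : ∀ {n f x y} → Symmetric f → x < n → Walk n f x y → Walk n f y x
walk-reverse symmetric x< start         = start
walk-reverse symmetric x< (next r _ e) =
  walk-trans (walk-edge (walk-end< x< r) (trans (symmetric _ _) e)) (walk-reverse symmetric x< r)

connected-from-root : ∀ n f → Symmetric f → (∀ x → x < suc n → Walk (suc n) f 0 x) → Connected (suc n) f
connected-from-root n f symmetric from-root x y x< y< =
  walk-trans (walk-reverse symmetric (s≤s z≤n) (from-root x x<)) (from-root y y<)

walk-map : ∀ {n m f g x y} (p : ℕ → ℕ) → (∀ z → z < n → p z < m) →
  (∀ w z → w < n → z < n → f w z ≡ true → Walk m g (p w) (p z)) → x < n → Walk n f x y → Walk m g (p x) (p y)
walk-map p p< edge⇒walk x< start          = start
walk-map p p< edge⇒walk x< (next r y< e) =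
  walk-trans (walk-map p p< edge⇒walk x< r) (edge⇒walk _ _ (walk-end< x< r) y< e)

-- Rooted graphs have their root at 0.  point is the one-vertex graph; pendant f adds a new root
-- adjacent only to the old root (now vertex 1); wedge a f g glues f, on the vertices 0 … a, and g at
-- their roots, the other vertices of g being moved up by a.
point : Adj
point _ _ = false

pendant : Adj → Adj
pendant f zero    zero    = false
pendant f zero    (suc y) = y ≡ᵇ 0
pendant f (suc x) zero    = x ≡ᵇ 0
pendant f (suc x) (suc y) = f x y

wedge : ℕ → Adj → Adj → Adj
wedge a f g zero    zero    = false
wedge a f g zero    (suc y) = if y <ᵇ a then f 0 (suc y) else g 0 (suc (y ∸ a))
wedge a f g (suc x) zero    = if x <ᵇ a then f (suc x) 0 else g (suc (x ∸ a)) 0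
wedge a f g (suc x) (suc y) =
  if x <ᵇ a then (if y <ᵇ a then f (suc x) (suc y) else false)
            else (if y <ᵇ a then false else g (suc (x ∸ a)) (suc (y ∸ a)))

-- The path with l + 1 vertices, rooted at an end.
path : ℕ → Adj
path zero    = point
path (suc l) = pendant (path l)

point-symmetric : Symmetric point
point-symmetric _ _ = refl

point-loopless : Loopless point
point-loopless _ = refl

connected-1 : ∀ f → Connected 1 f
connected-1 f zero    zero    _       _       = start
connected-1 f (suc x) _       (s≤s ()) _
connected-1 f zero    (suc y) _       (s≤s ())

pendant-symmetric : ∀ f → Symmetric f → Symmetric (pendant f)
pendant-symmetric f symmetric zero    zero    = refl
pendant-symmetric f symmetric zero    (suc y) = refl
pendant-symmetric f symmetric (suc x) zero    = refl
pendant-symmetric f symmetric (suc x) (suc y) = symmetric x y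

pendant-loopless : ∀ f → Loopless f → Loopless (pendant f)
pendant-loopless f loopless zero    = refl
pendant-loopless f loopless (suc x) = loopless x

wedge-symmetric : ∀ a f g → Symmetric f → Symmetric g → Symmetric (wedge a f g)
wedge-symmetric a f g sym-f sym-g zero    zero    = refl
wedge-symmetric a f g sym-f sym-g zero    (suc y) with y <ᵇ a
... | true  = sym-f _ _
... | false = sym-g _ _
wedge-symmetric a f g sym-f sym-g (suc x) zero with x <ᵇ a
... | true  = sym-f _ _
... | false = sym-g _ _
wedge-symmetric a f g sym-f sym-g (suc x) (suc y) with x <ᵇ a | y <ᵇ a
... | true  | true  = sym-f _ _
... | true  | false = refl
... | false | true  = refl
... | false | false = sym-g _ _

wedge-loopless : ∀ a f g → Loopless f → Loopless g → Loopless (wedge a f g)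
wedge-loopless a f g loopless-f loopless-g zero = refl
wedge-loopless a f g loopless-f loopless-g (suc x) with x <ᵇ a
... | true  = loopless-f _
... | false = loopless-g _

path-symmetric : ∀ l → Symmetric (path l)
path-symmetric zero    = point-symmetric
path-symmetric (suc l) = pendant-symmetric _ (path-symmetric l)

path-loopless : ∀ l → Loopless (path l)
path-loopless zero    = point-loopless
path-loopless (suc l) = pendant-loopless _ (path-loopless l)

pendant-connected : ∀ n f → Symmetric f → Connected (suc n) f → Connected (suc (suc n)) (pendant f)
pendant-connected n f symmetric connected =
  connected-from-root (suc n) (pendant f) (pendant-symmetric f symmetric) from-root
  where
  lift : ∀ {x y} → x < suc n → Walk (suc n) f x y → Walk (suc (suc n)) (pendant f) (suc x) (suc y)
  lift = walk-map suc (λ _ → s≤s) (λ w z _ z< e → walk-edge (s≤s z<) e)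
  from-root : ∀ x → x < suc (suc n) → Walk (suc (suc n)) (pendant f) 0 x
  from-root zero    _        = start
  from-root (suc x) (s≤s x<) = walk-trans (walk-edge (s≤s (s≤s z≤n)) refl)
    (lift (s≤s z≤n) (connected 0 x (s≤s z≤n) x<))

pendant-connected⁻ : ∀ n f → Connected (suc (suc n)) (pendant f) → Connected (suc n) f
pendant-connected⁻ n f connected x y x< y< =
  walk-map pred pred< edge⇒walk (s≤s x<) (connected (suc x) (suc y) (s≤s x<) (s≤s y<))
  where
  pred : ℕ → ℕ
  pred zero    = 0
  pred (suc x) = x
  pred< : ∀ z → z < suc (suc n) → pred z < suc n
  pred< zero    _        = s≤s z≤n
  pred< (suc z) (s≤s z<) = z<
  edge⇒walk : ∀ w z → w < suc (suc n) → z < suc (suc n) → pendant f w z ≡ true → Walk (suc n) f (pred w) (pred z)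
  edge⇒walk zero    (suc z) _ _        e rewrite ≡ᵇ⇒≡′ {z} e = start
  edge⇒walk (suc w) zero    _ _        e rewrite ≡ᵇ⇒≡′ {w} e = start
  edge⇒walk (suc w) (suc z) _ (s≤s z<) e = walk-edge z< e

wedge-left : ∀ a f g x y → x < suc a → y < suc a → Loopless f → wedge a f g x y ≡ f x y
wedge-left a f g zero    zero    _        _        loopless = sym (loopless 0)
wedge-left a f g zero    (suc y) _        (s≤s y<) loopless rewrite <ᵇ-true y< = refl
wedge-left a f g (suc x) zero    (s≤s x<) _        loopless rewrite <ᵇ-true x< = refl
wedge-left a f g (suc x) (suc y) (s≤s x<) (s≤s y<) loopless rewrite <ᵇ-true x< | <ᵇ-true y< = refl

rightIndex : ℕ → ℕ → ℕ
rightIndex a zero    = zero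
rightIndex a (suc y) = suc (a + y)

wedge-right : ∀ a f g x y → Loopless g → wedge a f g (rightIndex a x) (rightIndex a y) ≡ g x y
wedge-right a f g zero    zero    loopless = sym (loopless 0)
wedge-right a f g zero    (suc y) loopless rewrite <ᵇ-false (m≤m+n a y) | m+n∸m≡n a y = refl
wedge-right a f g (suc x) zero    loopless rewrite <ᵇ-false (m≤m+n a x) | m+n∸m≡n a x = refl
wedge-right a f g (suc x) (suc y) loopless
  rewrite <ᵇ-false (m≤m+n a x) | <ᵇ-false (m≤m+n a y) | m+n∸m≡n a x | m+n∸m≡n a y = refl

rightIndex-bound : ∀ a b z → z < suc b → rightIndex a z < suc (a + b)
rightIndex-bound a b zero    _        = s≤s z≤n
rightIndex-bound a b (suc z) (s≤s z<) = s≤s (+-monoʳ-< a z<)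

∸-<-cancel : ∀ {a b z} → a ≤ z → z < a + b → z ∸ a < b
∸-<-cancel {a} {b} {z} a≤z z< =
  +-cancelˡ-< a (z ∸ a) b (subst (_< a + b) (sym (trans (+-comm a (z ∸ a)) (m∸n+n≡m a≤z))) z<)

wedge-connected : ∀ a b f g → Symmetric f → Symmetric g → Loopless f → Loopless g →
  Connected (suc a) f → Connected (suc b) g → Connected (suc (a + b)) (wedge a f g)
wedge-connected a b f g sym-f sym-g loopless-f loopless-g connected-f connected-g =
  connected-from-root (a + b) _ (wedge-symmetric a f g sym-f sym-g) from-root
  where
  from-root : ∀ x → x < suc (a + b) → Walk (suc (a + b)) (wedge a f g) 0 x
  from-root zero    _        = start
  from-root (suc x) (s≤s x<) with <ᵇ-cases x a
  ... | inj₁ (_ , x<a) =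
    walk-map id (λ z z< → ≤-trans z< (s≤s (m≤m+n a b)))
      (λ w z w< z< e → walk-edge (≤-trans z< (s≤s (m≤m+n a b))) (trans (wedge-left a f g w z w< z< loopless-f) e))
      (s≤s z≤n) (connected-f 0 (suc x) (s≤s z≤n) (s≤s x<a))
  ... | inj₂ (_ , a≤x) =
    subst (Walk _ _ 0) (cong suc (trans (+-comm a (x ∸ a)) (m∸n+n≡m a≤x)))
      (walk-map (rightIndex a) (rightIndex-bound a b)
        (λ w z w< z< e → walk-edge (rightIndex-bound a b z z<) (trans (wedge-right a f g w z loopless-g) e))
        (s≤s z≤n) (connected-g 0 (suc (x ∸ a)) (s≤s z≤n) (s≤s (∸-<-cancel a≤x x<))))

leftProj : ℕ → ℕ → ℕ
leftProj a zero    = zero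
leftProj a (suc x) = if x <ᵇ a then suc x else zero

rightProj : ℕ → ℕ → ℕ
rightProj a zero    = zero
rightProj a (suc x) = if x <ᵇ a then zero else suc (x ∸ a)

-- Projecting a walk of the wedge onto one side contracts the other side to the root.
wedge-connected⁻ˡ : ∀ a b f g → Loopless f → Connected (suc (a + b)) (wedge a f g) → Connected (suc a) f
wedge-connected⁻ˡ a b f g loopless-f connected x y x< y< =
  subst₂ (Walk (suc a) f) (leftProj-left x x<) (leftProj-left y y<)
    (walk-map (leftProj a) leftProj< edge⇒walk (widen x<) (connected x y (widen x<) (widen y<)))
  where
  widen : ∀ {z} → z < suc a → z < suc (a + b)
  widen z< = ≤-trans z< (s≤s (m≤m+n a b))
  leftProj-left : ∀ x → x < suc a → leftProj a x ≡ x
  leftProj-left zero    _        = refl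
  leftProj-left (suc x) (s≤s x<) rewrite <ᵇ-true x< = refl
  leftProj< : ∀ z → z < suc (a + b) → leftProj a z < suc a
  leftProj< zero    _ = s≤s z≤n
  leftProj< (suc z) _ with <ᵇ-cases z a
  ... | inj₁ (z<ᵇa , z<a) rewrite z<ᵇa = s≤s z<a
  ... | inj₂ (z≮ᵇa , _)   rewrite z≮ᵇa = s≤s z≤n
  edge⇒walk : ∀ w z → w < suc (a + b) → z < suc (a + b) → wedge a f g w z ≡ true →
    Walk (suc a) f (leftProj a w) (leftProj a z)
  edge⇒walk zero (suc z) _ _ e with <ᵇ-cases z a
  ... | inj₁ (q , z<a) rewrite q = walk-edge (s≤s z<a) e
  ... | inj₂ (q , _)   rewrite q = start
  edge⇒walk (suc w) zero _ _ e with <ᵇ-cases w a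
  ... | inj₁ (q , _) rewrite q = walk-edge (s≤s z≤n) e
  ... | inj₂ (q , _) rewrite q = start
  edge⇒walk (suc w) (suc z) _ _ e with <ᵇ-cases w a | <ᵇ-cases z a
  ... | inj₁ (q , _) | inj₁ (q′ , z<a) rewrite q | q′ = walk-edge (s≤s z<a) e
  ... | inj₁ (q , _) | inj₂ (q′ , _)   rewrite q | q′ = ⊥-elim (false≢true e)
  ... | inj₂ (q , _) | inj₁ (q′ , _)   rewrite q | q′ = ⊥-elim (false≢true e)
  ... | inj₂ (q , _) | inj₂ (q′ , _)   rewrite q | q′ = start

wedge-connected⁻ʳ : ∀ a b f g → Loopless g → Connected (suc (a + b)) (wedge a f g) → Connected (suc b) g
wedge-connected⁻ʳ a b f g loopless-g connected x y x< y< =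
  subst₂ (Walk (suc b) g) (rightProj-right x) (rightProj-right y)
    (walk-map (rightProj a) rightProj< edge⇒walk (rightIndex-bound a b x x<)
      (connected (rightIndex a x) (rightIndex a y) (rightIndex-bound a b x x<) (rightIndex-bound a b y y<)))
  where
  rightProj-right : ∀ x → rightProj a (rightIndex a x) ≡ x
  rightProj-right zero    = refl
  rightProj-right (suc x) rewrite <ᵇ-false (m≤m+n a x) | m+n∸m≡n a x = refl
  rightProj< : ∀ z → z < suc (a + b) → rightProj a z < suc b
  rightProj< zero    _        = s≤s z≤n
  rightProj< (suc z) (s≤s z<) with <ᵇ-cases z a
  ... | inj₁ (q , _)   rewrite q = s≤s z≤n
  ... | inj₂ (q , a≤z) rewrite q = s≤s (∸-<-cancel a≤z z<)
  edge⇒walk : ∀ w z → w < suc (a + b) → z < suc (a + b) → wedge a f g w z ≡ true →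
    Walk (suc b) g (rightProj a w) (rightProj a z)
  edge⇒walk zero (suc z) _ (s≤s z<) e with <ᵇ-cases z a
  ... | inj₁ (q , _)   rewrite q = start
  ... | inj₂ (q , a≤z) rewrite q = walk-edge (s≤s (∸-<-cancel a≤z z<)) e
  edge⇒walk (suc w) zero _ _ e with <ᵇ-cases w a
  ... | inj₁ (q , _) rewrite q = start
  ... | inj₂ (q , _) rewrite q = walk-edge (s≤s z≤n) e
  edge⇒walk (suc w) (suc z) _ (s≤s z<) e with <ᵇ-cases w a | <ᵇ-cases z a
  ... | inj₁ (q , _) | inj₁ (q′ , _)   rewrite q | q′ = start
  ... | inj₁ (q , _) | inj₂ (q′ , _)   rewrite q | q′ = ⊥-elim (false≢true e)
  ... | inj₂ (q , _) | inj₁ (q′ , _)   rewrite q | q′ = ⊥-elim (false≢true e)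
  ... | inj₂ (q , _) | inj₂ (q′ , a≤z) rewrite q | q′ = walk-edge (s≤s (∸-<-cancel a≤z z<)) e

GraphPred : Set₁
GraphPred = ℕ → Adj → Set

-- The legal moves of a rooted graph f on suc n vertices, split by whether they delete the root.
-- A root-avoiding move leaves a graph on suc m vertices, passed to Φ as m; a move deleting the
-- root may leave nothing, so Ψ gets the exact number of remaining vertices.
AvoidingSingle : ℕ → Adj → GraphPred → Set
AvoidingSingle m f Φ = Σ ℕ λ i → i < suc m × Connected (suc m) (delete (suc i) f) × Φ m (delete (suc i) f)

AvoidingPair : ℕ → Adj → GraphPred → Set
AvoidingPair zero    f Φ = ⊥
AvoidingPair (suc m) f Φ = Σ ℕ λ i → Σ ℕ λ j →
  i < suc (suc m) × j < suc m × f (suc i) (suc (punchInℕ i j)) ≡ true ×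
  Connected (suc m) (delete (suc j) (delete (suc i) f)) × Φ m (delete (suc j) (delete (suc i) f))

AvoidingMove : ℕ → Adj → GraphPred → Set
AvoidingMove zero    f Φ = ⊥
AvoidingMove (suc m) f Φ = AvoidingSingle m f Φ ⊎ AvoidingPair m f Φ

RootPair : ℕ → Adj → GraphPred → Set
RootPair zero    f Ψ = ⊥
RootPair (suc m) f Ψ = Σ ℕ λ j → j < suc m × f 0 (suc j) ≡ true ×
  Connected m (delete j (delete 0 f)) × Ψ m (delete j (delete 0 f))

RootMove : ℕ → Adj → GraphPred → Set
RootMove n f Ψ = (Connected n (delete 0 f) × Ψ n (delete 0 f)) ⊎ RootPair n f Ψ

HasValue : ℕ → GraphPred
HasValue k m g = 𝒢 (suc m) g ≡ k

HasValue₀ : ℕ → GraphPred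
HasValue₀ k s g = 𝒢 s g ≡ k

delete-0-comm : ∀ i f x y → delete 0 (delete (suc i) f) x y ≡ delete i (delete 0 f) x y
delete-0-comm i f x y = cong₂ f (punchInℕ-suc i x) (punchInℕ-suc i y)

option-split : ∀ n f k → Symmetric f → OptionValue n f k →
  AvoidingMove n f (HasValue k) ⊎ RootMove n f (HasValue₀ k)
option-split n f k symmetric (inj₁ (zero , _ , connected , value)) = inj₂ (inj₁ (connected , value))
option-split (suc m) f k symmetric (inj₁ (suc i , s≤s i< , connected , value)) =
  inj₁ (inj₁ (i , i< , connected , value))
option-split (suc m) f k symmetric (inj₂ (zero , j , _ , j< , edge , connected , value)) =
  inj₂ (inj₂ (j , j< , edge , connected , value))
option-split (suc m) f k symmetric (inj₂ (suc i , zero , s≤s i< , _ , edge , connected , value)) =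
  inj₂ (inj₂ (i , i< , trans (symmetric 0 (suc i)) edge , Connected-cong m _ _ swap connected ,
               trans (sym (𝒢-cong m _ _ swap)) value))
  where
  swap : Agree m (delete 0 (delete (suc i) f)) (delete i (delete 0 f))
  swap = pointwise⇒Agree (delete-0-comm i f)
option-split (suc (suc m)) f k symmetric (inj₂ (suc i , suc j , s≤s i< , s≤s j< , edge , connected , value)) =
  inj₁ (inj₂ (i , j , i< , j< , trans (cong (f (suc i)) (sym (punchInℕ-suc i j))) edge , connected , value))

avoiding⇒option : ∀ n f k → AvoidingMove n f (HasValue k) → OptionValue n f k
avoiding⇒option (suc m) f k (inj₁ (i , i< , connected , value)) = inj₁ (suc i , s≤s i< , connected , value)
avoiding⇒option (suc (suc m)) f k (inj₂ (i , j , i< , j< , edge , connected , value)) =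
  inj₂ (suc i , suc j , s≤s i< , s≤s j< , trans (cong (f (suc i)) (punchInℕ-suc i j)) edge , connected , value)

root⇒option : ∀ n f k → RootMove n f (HasValue₀ k) → OptionValue n f k
root⇒option n       f k (inj₁ (connected , value)) = inj₁ (0 , s≤s z≤n , connected , value)
root⇒option (suc m) f k (inj₂ (j , j< , edge , connected , value)) =
  inj₂ (0 , j , s≤s z≤n , j< , edge , connected , value)

Resp : GraphPred → Set
Resp Φ = ∀ m g g′ → Agree (suc m) g g′ → Φ m g → Φ m g′

Resp₀ : GraphPred → Set
Resp₀ Ψ = ∀ s g g′ → Agree s g g′ → Ψ s g → Ψ s g′

HasValue-resp : ∀ k → Resp (HasValue k)
HasValue-resp k m g g′ agree value = trans (sym (𝒢-cong (suc m) g g′ agree)) value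

HasValue₀-resp : ∀ k → Resp₀ (HasValue₀ k)
HasValue₀-resp k s g g′ agree value = trans (sym (𝒢-cong s g g′ agree)) value

root-resp : ∀ n f f′ Ψ → Resp₀ Ψ → Agree (suc n) f f′ → RootMove n f Ψ → RootMove n f′ Ψ
root-resp n f f′ Ψ resp agree (inj₁ (connected , p)) =
  inj₁ (Connected-cong _ _ _ (Agree-delete 0 agree) connected , resp n _ _ (Agree-delete 0 agree) p)
root-resp (suc m) f f′ Ψ resp agree (inj₂ (j , j< , edge , connected , p)) =
  inj₂ (j , j< , trans (sym (agree _ _ (s≤s z≤n) (s≤s j<))) edge ,
    Connected-cong _ _ _ agree′ connected , resp m _ _ agree′ p)
  where
  agree′ : Agree m (delete j (delete 0 f)) (delete j (delete 0 f′))
  agree′ = Agree-delete j (Agree-delete 0 agree)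

isolated-root⇒disconnected : ∀ m g → (∀ z → g 0 z ≡ false) → ¬ Connected (suc (suc m)) g
isolated-root⇒disconnected m g isolated connected =
  false≢true (walk-preserves (λ w → w ≡ᵇ 0) stays-at-root (connected 0 1 (s≤s z≤n) (s≤s (s≤s z≤n))) refl)
  where
  stays-at-root : ∀ w z → (w ≡ᵇ 0) ≡ true → g w z ≡ true → (z ≡ᵇ 0) ≡ true
  stays-at-root zero z _ e = ⊥-elim (false≢true (trans (sym (isolated z)) e))

Agree-point : ∀ g → Loopless g → Agree 1 g point
Agree-point g loopless zero    zero    _        _        = loopless 0
Agree-point g loopless (suc x) _       (s≤s ()) _
Agree-point g loopless zero    (suc y) _        (s≤s ())

connected-2⇒edge : ∀ f → Loopless f → Connected 2 f → f 0 1 ≡ true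
connected-2⇒edge f loopless connected = last-edge (connected 0 1 (s≤s z≤n) (s≤s (s≤s z≤n))) refl
  where
  last-edge : ∀ {y} → Walk 2 f 0 y → y ≡ 1 → f 0 1 ≡ true
  last-edge (next {zero} r _ e)          refl = e
  last-edge (next {suc zero} r _ e)      refl = ⊥-elim (false≢true (trans (sym (loopless 1)) e))
  last-edge (next {suc (suc w)} r _ e)   refl = ⊥-elim (<⇒≱ (walk-end< (s≤s z≤n) r) (s≤s (s≤s z≤n)))

punchInℕ-suc-≡ᵇ0 : ∀ i y → (punchInℕ (suc i) y ≡ᵇ 0) ≡ (y ≡ᵇ 0)
punchInℕ-suc-≡ᵇ0 i zero    = refl
punchInℕ-suc-≡ᵇ0 i (suc y) rewrite punchInℕ-suc i y = refl

delete-pendant : ∀ f i x y → delete (suc (suc i)) (pendant f) x y ≡ pendant (delete (suc i) f) x y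
delete-pendant f i zero    zero    = refl
delete-pendant f i zero    (suc y) rewrite punchInℕ-suc (suc i) y = punchInℕ-suc-≡ᵇ0 i y
delete-pendant f i (suc x) zero    rewrite punchInℕ-suc (suc i) x = punchInℕ-suc-≡ᵇ0 i x
delete-pendant f i (suc x) (suc y) rewrite punchInℕ-suc (suc i) x | punchInℕ-suc (suc i) y = refl

delete²-pendant : ∀ f i j x y →
  delete (suc (suc j)) (delete (suc (suc i)) (pendant f)) x y ≡ pendant (delete (suc j) (delete (suc i) f)) x y
delete²-pendant f i j x y =
  trans (delete-pendant f i (punchInℕ (suc (suc j)) x) (punchInℕ (suc (suc j)) y))
    (delete-pendant (delete (suc i) f) j x y)

pendant-root-isolated : ∀ f z → delete 1 (pendant f) 0 z ≡ false
pendant-root-isolated f zero    = refl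
pendant-root-isolated f (suc z) = refl

-- Deleting the old root (vertex 1) isolates the new one, so a root-avoiding move of pendant f
-- either keeps vertex 1, and is then a root-avoiding move of f, or leaves a single vertex.
avoiding-pendant⁻ : ∀ n f Φ → Resp Φ → Loopless f → AvoidingMove (suc n) (pendant f) Φ →
  AvoidingMove n f (λ m g → Φ (suc m) (pendant g)) ⊎ (n ≤ 1 × Φ 0 point)
avoiding-pendant⁻ zero f Φ resp loopless (inj₁ (zero , _ , _ , p)) =
  inj₂ (z≤n , resp 0 _ point (Agree-point _ (delete-loopless 1 (pendant f) (pendant-loopless f loopless))) p)
avoiding-pendant⁻ zero f Φ resp loopless (inj₁ (suc i , s≤s () , _))
avoiding-pendant⁻ (suc n) f Φ resp loopless (inj₁ (zero , _ , connected , _)) =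
  ⊥-elim (isolated-root⇒disconnected n (delete 1 (pendant f)) (pendant-root-isolated f) connected)
avoiding-pendant⁻ (suc n) f Φ resp loopless (inj₁ (suc i , s≤s i< , connected , p)) =
  inj₁ (inj₁ (i , i< , pendant-connected⁻ n (delete (suc i) f) (Connected-cong (suc (suc n)) _ _ agree connected) ,
              resp (suc n) _ _ agree p))
  where
  agree : Agree (suc (suc n)) (delete (suc (suc i)) (pendant f)) (pendant (delete (suc i) f))
  agree = pointwise⇒Agree (delete-pendant f i)
avoiding-pendant⁻ (suc zero) f Φ resp loopless (inj₂ (i , j , _ , _ , _ , _ , p)) =
  inj₂ (s≤s z≤n , resp 0 _ point (Agree-point _
    (delete-loopless (suc j) (delete (suc i) (pendant f))
    (delete-loopless (suc i) (pendant f) (pendant-loopless f loopless)))) p)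
avoiding-pendant⁻ (suc (suc m)) f Φ resp loopless (inj₂ (zero , j , _ , _ , _ , connected , _)) =
  ⊥-elim (isolated-root⇒disconnected m (delete (suc j) (delete 1 (pendant f)))
           (λ z → pendant-root-isolated f (punchInℕ (suc j) z)) connected)
avoiding-pendant⁻ (suc (suc m)) f Φ resp loopless (inj₂ (suc i , zero , _ , _ , _ , connected , _)) =
  ⊥-elim (isolated-root⇒disconnected m (delete 1 (delete (suc (suc i)) (pendant f)))
           (λ z → trans (delete-pendant f i 0 (punchInℕ 1 z))
             (pendant-root-isolated (delete (suc i) f) z)) connected)
avoiding-pendant⁻ (suc (suc m)) f Φ resp loopless (inj₂ (suc i , suc j , s≤s i< , s≤s j< , edge , connected , p)) =
  inj₁ (inj₂ (i , j , i< , j< , trans (cong (f (suc i)) (sym (punchInℕ-suc i j))) edge ,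
              pendant-connected⁻ m (delete (suc j) (delete (suc i) f))
                (Connected-cong (suc (suc m)) _ _ agree connected) ,
              resp (suc m) _ _ agree p))
  where
  agree : Agree (suc (suc m)) (delete (suc (suc j)) (delete (suc (suc i)) (pendant f)))
    (pendant (delete (suc j) (delete (suc i) f)))
  agree = pointwise⇒Agree (delete²-pendant f i j)

avoiding-pendant⁺ : ∀ n f Φ → Resp Φ → Symmetric f →
  AvoidingMove n f (λ m g → Φ (suc m) (pendant g)) → AvoidingMove (suc n) (pendant f) Φ
avoiding-pendant⁺ (suc n) f Φ resp symmetric (inj₁ (i , i< , connected , p)) =
  inj₁ (suc i , s≤s i< ,
        Connected-cong (suc (suc n)) _ _ agree (pendant-connected n (delete (suc i) f)
          (delete-symmetric (suc i) f symmetric) connected) ,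
        resp (suc n) _ _ agree p)
  where
  agree : Agree (suc (suc n)) (pendant (delete (suc i) f)) (delete (suc (suc i)) (pendant f))
  agree = pointwise⇒Agree (λ x y → sym (delete-pendant f i x y))
avoiding-pendant⁺ (suc (suc m)) f Φ resp symmetric (inj₂ (i , j , i< , j< , edge , connected , p)) =
  inj₂ (suc i , suc j , s≤s i< , s≤s j< , trans (cong (f (suc i)) (punchInℕ-suc i j)) edge ,
        Connected-cong (suc (suc m)) _ _ agree
          (pendant-connected m (delete (suc j) (delete (suc i) f))
            (delete-symmetric (suc j) (delete (suc i) f) (delete-symmetric (suc i) f symmetric)) connected) ,
        resp (suc m) _ _ agree p)
  where
  agree : Agree (suc (suc m)) (pendant (delete (suc j) (delete (suc i) f)))
    (delete (suc (suc j)) (delete (suc (suc i)) (pendant f)))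
  agree = pointwise⇒Agree (λ x y → sym (delete²-pendant f i j x y))

avoiding-pendant⁺-P₂ : ∀ f Φ → Resp Φ → Loopless f → Φ 0 point → AvoidingMove 1 (pendant f) Φ
avoiding-pendant⁺-P₂ f Φ resp loopless p =
  inj₁ (0 , s≤s z≤n , connected-1 _ ,
        resp 0 point _ (Agree-sym (Agree-point _ (delete-loopless 1 (pendant f) (pendant-loopless f loopless)))) p)

avoiding-pendant⁺-P₃ : ∀ f Φ → Resp Φ → Loopless f → Connected 2 f → Φ 0 point → AvoidingMove 2 (pendant f) Φ
avoiding-pendant⁺-P₃ f Φ resp loopless connected p =
  inj₂ (0 , 0 , s≤s z≤n , s≤s z≤n , connected-2⇒edge f loopless connected , connected-1 _ ,
        resp 0 point _ (Agree-sym (Agree-point _ (delete-loopless 1 (delete 1 (pendant f))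
          (delete-loopless 1 (pendant f) (pendant-loopless f loopless))))) p)

root-pendant⁻ : ∀ n f Ψ → RootMove (suc n) (pendant f) Ψ →
  Ψ (suc n) f ⊎ (Connected n (delete 0 f) × Ψ n (delete 0 f))
root-pendant⁻ n f Ψ (inj₁ (_ , p))                      = inj₁ p
root-pendant⁻ n f Ψ (inj₂ (zero , _ , _ , connected , p)) = inj₂ (connected , p)
root-pendant⁻ n f Ψ (inj₂ (suc j , _ , () , _ , _))

root-pendant⁺-root : ∀ n f Ψ → Connected (suc n) f → Ψ (suc n) f → RootMove (suc n) (pendant f) Ψ
root-pendant⁺-root n f Ψ connected p = inj₁ (connected , p)

root-pendant⁺-pair : ∀ n f Ψ → Connected n (delete 0 f) → Ψ n (delete 0 f) → RootMove (suc n) (pendant f) Ψ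
root-pendant⁺-pair n f Ψ connected p = inj₂ (0 , s≤s z≤n , refl , connected , p)

<-or-+ : ∀ a x → x < a ⊎ Σ ℕ (λ x′ → x ≡ a + x′)
<-or-+ zero    x       = inj₂ (x , refl)
<-or-+ (suc a) zero    = inj₁ (s≤s z≤n)
<-or-+ (suc a) (suc x) with <-or-+ a x
... | inj₁ x<a        = inj₁ (s≤s x<a)
... | inj₂ (x′ , x≡) = inj₂ (x′ , cong suc x≡)

punchInℕ-+ : ∀ a i j → punchInℕ (a + i) (a + j) ≡ a + punchInℕ i j
punchInℕ-+ zero i j = refl
punchInℕ-+ (suc a) i j = trans (punchInℕ-suc (a + i) (a + j)) (cong suc (punchInℕ-+ a i j))

punchInℕ-below : ∀ a i x → x < a → punchInℕ (a + i) x ≡ x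
punchInℕ-below a i x l = punchInℕ-< (≤-trans l (m≤m+n a i))

data LeftShift (a i x : ℕ) : Set where
  stays-left : (x <ᵇ a) ≡ true → (punchInℕ i x <ᵇ suc a) ≡ true → LeftShift a i x
  shifted    : (x <ᵇ a) ≡ false → punchInℕ i x ≡ suc x → LeftShift a i x

leftShift : ∀ a i x → i < suc a → LeftShift a i x
leftShift a i x i≤a with <ᵇ-cases x a
... | inj₁ (x<ᵇa , x<a) = stays-left x<ᵇa (<ᵇ-true (punchInℕ-bound {i} x<a))
... | inj₂ (x≮ᵇa , a≤x) = shifted x≮ᵇa (punchInℕ-≥ (≤-trans (≤-pred i≤a) a≤x))

delete-wedge-left : ∀ a f g i → i < suc a → ∀ x y →
  delete (suc i) (wedge (suc a) f g) x y ≡ wedge a (delete (suc i) f) g x y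
delete-wedge-left a f g i i≤a zero zero = refl
delete-wedge-left a f g i i≤a zero (suc y) rewrite punchInℕ-suc i y with leftShift a i y i≤a
... | stays-left p q rewrite p | q = refl
... | shifted p q    rewrite q | p = refl
delete-wedge-left a f g i i≤a (suc x) zero rewrite punchInℕ-suc i x with leftShift a i x i≤a
... | stays-left p q rewrite p | q = refl
... | shifted p q    rewrite q | p = refl
delete-wedge-left a f g i i≤a (suc x) (suc y) rewrite punchInℕ-suc i x | punchInℕ-suc i y
  with leftShift a i x i≤a | leftShift a i y i≤a
... | stays-left p q | stays-left p′ q′ rewrite p | q | p′ | q′ = refl
... | stays-left p q | shifted p′ q′    rewrite q′ | p | q | p′ = refl
... | shifted p q    | stays-left p′ q′ rewrite q | p | p′ | q′ = refl
... | shifted p q    | shifted p′ q′    rewrite q | q′ | p | p′ = refl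

delete-wedge-right : ∀ a f g i x y → delete (suc (a + i)) (wedge a f g) x y ≡ wedge a f (delete (suc i) g) x y
delete-wedge-right a f g i zero zero = refl
delete-wedge-right a f g i zero (suc y) rewrite punchInℕ-suc (a + i) y with <-or-+ a y
... | inj₁ l rewrite punchInℕ-below a i y l | <ᵇ-true l = refl
... | inj₂ (y' , refl) rewrite punchInℕ-+ a i y' | <ᵇ-false (m≤m+n a (punchInℕ i y')) | <ᵇ-false
    (m≤m+n a y') | m+n∸m≡n a (punchInℕ i y') | m+n∸m≡n a y' | punchInℕ-suc i y' = refl
delete-wedge-right a f g i (suc x) zero rewrite punchInℕ-suc (a + i) x with <-or-+ a x
... | inj₁ l rewrite punchInℕ-below a i x l | <ᵇ-true l = refl
... | inj₂ (x' , refl) rewrite punchInℕ-+ a i x' | <ᵇ-false (m≤m+n a (punchInℕ i x')) | <ᵇ-false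
    (m≤m+n a x') | m+n∸m≡n a (punchInℕ i x') | m+n∸m≡n a x' | punchInℕ-suc i x' = refl
delete-wedge-right a f g i (suc x) (suc y) rewrite punchInℕ-suc (a + i) x | punchInℕ-suc
  (a + i) y with <-or-+ a x | <-or-+ a y
... | inj₁ l | inj₁ l' rewrite punchInℕ-below a i x l | <ᵇ-true l | punchInℕ-below a i y l' | <ᵇ-true l' = refl
... | inj₁ l | inj₂ (y' , refl) rewrite punchInℕ-below a i x l | <ᵇ-true l | punchInℕ-+ a i y' | <ᵇ-false
    (m≤m+n a (punchInℕ i y')) | <ᵇ-false (m≤m+n a y') = refl
... | inj₂ (x' , refl) | inj₁ l' rewrite punchInℕ-below a i y l' | <ᵇ-true l' | punchInℕ-+ a i x' | <ᵇ-false
    (m≤m+n a (punchInℕ i x')) | <ᵇ-false (m≤m+n a x') = refl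
... | inj₂ (x' , refl) | inj₂ (y' , refl) rewrite punchInℕ-+ a i x' | <ᵇ-false
    (m≤m+n a (punchInℕ i x')) | <ᵇ-false (m≤m+n a x') | m+n∸m≡n a
    (punchInℕ i x') | m+n∸m≡n a x' | punchInℕ-suc i x'
   | punchInℕ-+ a i y' | <ᵇ-false (m≤m+n a (punchInℕ i y')) | <ᵇ-false (m≤m+n a y') | m+n∸m≡n a
     (punchInℕ i y') | m+n∸m≡n a y' | punchInℕ-suc i y' = refl

resp-size : ∀ Φ → Resp Φ → ∀ {m m′ g g′} → m ≡ m′ → Agree (suc m) g g′ → Φ m g → Φ m′ g′
resp-size Φ resp refl agree p = resp _ _ _ agree p

resp₀-size : ∀ Ψ → Resp₀ Ψ → ∀ {s s′ g g′} → s ≡ s′ → Agree s g g′ → Ψ s g → Ψ s′ g′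
resp₀-size Ψ resp refl agree p = resp _ _ _ agree p

Connected-cong′ : ∀ {n n′ f g} → n ≡ n′ → Agree n f g → Connected n f → Connected n′ g
Connected-cong′ refl = Connected-cong _ _ _

Agree-cong-size : ∀ {n n′ f g} → n ≡ n′ → Agree n f g → Agree n′ f g
Agree-cong-size refl agree = agree

wedge-no-cross : ∀ a f g i p → i < a → a ≤ p → wedge a f g (suc i) (suc p) ≡ false
wedge-no-cross a f g i p i<a a≤p rewrite <ᵇ-true i<a | <ᵇ-false a≤p = refl

wedge-no-cross′ : ∀ a f g i p → a ≤ i → p < a → wedge a f g (suc i) (suc p) ≡ false
wedge-no-cross′ a f g i p a≤i p<a rewrite <ᵇ-false a≤i | <ᵇ-true p<a = refl

avoidingPair-view : ∀ n f Φ → AvoidingPair n f Φ → Σ ℕ λ m → (n ≡ suc m) × AvoidingPair (suc m) f Φ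
avoidingPair-view (suc m) f Φ p = m , refl , p

avoidingPair-intro : ∀ n m f Φ → n ≡ suc m → AvoidingPair (suc m) f Φ → AvoidingPair n f Φ
avoidingPair-intro .(suc m) m f Φ refl p = p

<-suc-+ : ∀ {a b x} → x < suc a → x < suc (a + b)
<-suc-+ {a} {b} x< = ≤-trans x< (s≤s (m≤m+n a b))

OnLeft : ℕ → Adj → GraphPred → GraphPred
OnLeft b g Φ m f′ = Φ (m + b) (wedge m f′ g)

OnRight : ℕ → Adj → GraphPred → GraphPred
OnRight a f Φ m g′ = Φ (a + m) (wedge a f g′)

avoiding-wedge-single⁻ : ∀ a' b f g Φ → Resp Φ → Loopless f → Loopless g →
  AvoidingSingle (a' + b) (wedge (suc a') f g) Φ →
  AvoidingMove (suc a') f (OnLeft b g Φ) ⊎ AvoidingMove b g (OnRight (suc a') f Φ)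
avoiding-wedge-single⁻ a' b f g Φ resp loopless-f loopless-g (i , i< , connected , p) with <-or-+ (suc a') i
... | inj₁ l = inj₁ (inj₁ (i , l , wedge-connected⁻ˡ a' b (delete (suc i) f) g
    (delete-loopless (suc i) f loopless-f) (Connected-cong _ _ _ agree connected) ,
       resp (a' + b) (delete (suc i) (wedge (suc a') f g)) (wedge a' (delete (suc i) f) g) agree p))
  where
  agree : Agree (suc (a' + b)) (delete (suc i) (wedge (suc a') f g)) (wedge a' (delete (suc i) f) g)
  agree = pointwise⇒Agree (delete-wedge-left a' f g i l)
... | inj₂ (i' , refl) = in-right b i< connected p
  where
  a : ℕ
  a = suc a'
  in-right : ∀ b → a + i' < suc (a' + b) → Connected (suc (a' + b)) (delete (suc (a + i')) (wedge a f g)) →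
        Φ (a' + b) (delete (suc (a + i')) (wedge a f g)) →
          AvoidingMove (suc a') f (OnLeft b g Φ) ⊎ AvoidingMove b g (OnRight a f Φ)
  in-right zero i< connected p = ⊥-elim (<⇒≱ i< (s≤s (≤-trans (≤-reflexive (+-identityʳ a')) (m≤m+n a' i'))))
  in-right (suc b') i< connected p = inj₂ (inj₁ (i' , +-cancelˡ-< a i' (suc b') i< ,
    wedge-connected⁻ʳ a b' f (delete (suc i') g) (delete-loopless (suc i') g loopless-g)
      (Connected-cong′ (cong suc (+-suc a' b')) agree connected) ,
    resp-size Φ resp (+-suc a' b') agree p))
    where
    agree : Agree (suc (a' + suc b')) (delete (suc (a + i')) (wedge a f g)) (wedge a f (delete (suc i') g))
    agree = pointwise⇒Agree (delete-wedge-right a f g i')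

avoiding-wedge-pairˡ⁻ : ∀ a' b f g Φ → Resp Φ → Loopless f → ∀ m → (a' + b ≡ suc m) → ∀ i j → i < suc a' → j < a' →
  wedge (suc a') f g (suc i) (suc (punchInℕ i j)) ≡ true →
  Connected (suc m) (delete (suc j) (delete (suc i) (wedge (suc a') f g))) →
  Φ m (delete (suc j) (delete (suc i) (wedge (suc a') f g))) → AvoidingMove (suc a') f (OnLeft b g Φ)
avoiding-wedge-pairˡ⁻ (suc a'') b f g Φ resp loopless-f m size i j i< j< edge connected p = inj₂ (i , j , i< , j< ,
  trans (sym (wedge-left (suc (suc a'')) f g (suc i) (suc (punchInℕ i j)) (s≤s i<)
    (s≤s (punchInℕ-bound {i} j<)) loopless-f)) edge ,
  wedge-connected⁻ˡ a'' b (delete (suc j) (delete (suc i) f)) g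
    (delete-loopless (suc j) (delete (suc i) f) (delete-loopless (suc i) f loopless-f))
    (Connected-cong′ (cong suc size≡) agree connected) ,
  resp-size Φ resp size≡ agree p)
  where
  size≡ : m ≡ a'' + b
  size≡ = sym (suc-injective size)
  agree : Agree (suc m) (delete (suc j) (delete (suc i) (wedge (suc (suc a'')) f g)))
    (wedge a'' (delete (suc j) (delete (suc i) f)) g)
  agree = pointwise⇒Agree (λ x y → trans (delete-wedge-left (suc a'') f g i i< (punchInℕ (suc j) x)
    (punchInℕ (suc j) y)) (delete-wedge-left a'' (delete (suc i) f) g j j< x y))

avoiding-wedge-pairʳ⁻ : ∀ a' b f g Φ → Resp Φ → Loopless g → ∀ m →
  (a' + b ≡ suc m) → ∀ i' j' → suc a' + i' < suc (suc m) → suc a' + j' < suc m →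
  wedge (suc a') f g (suc (suc a' + i')) (suc (punchInℕ (suc a' + i') (suc a' + j'))) ≡ true →
  Connected (suc m) (delete (suc (suc a' + j')) (delete (suc (suc a' + i')) (wedge (suc a') f g))) →
  Φ m (delete (suc (suc a' + j')) (delete (suc (suc a' + i')) (wedge (suc a') f g))) →
    AvoidingMove b g (OnRight (suc a') f Φ)
avoiding-wedge-pairʳ⁻ a' zero f g Φ resp loopless-g m size i' j' i< j< edge connected p =
  ⊥-elim (<⇒≱ (≤-trans j< (≤-reflexive (trans (sym size) (+-identityʳ a')))) (≤-trans (m≤m+n a' j') (n≤1+n _)))
avoiding-wedge-pairʳ⁻ a' (suc zero) f g Φ resp loopless-g m size i' j' i< j< edge connected p =
  ⊥-elim (<⇒≱ (≤-pred (≤-trans j< (≤-reflexive (trans (sym size) (+-comm a' 1))))) (m≤m+n a' j'))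
avoiding-wedge-pairʳ⁻ a' (suc (suc b'')) f g Φ resp loopless-g m size i' j' i< j< edge connected p =
  inj₂ (i' , j' , i<′ , j<′ ,
  trans (sym (trans (cong (λ z → wedge a f g (suc (a + i')) (suc z)) (punchInℕ-+ a i' j'))
    (wedge-right a f g (suc i') (suc (punchInℕ i' j')) loopless-g))) edge ,
  wedge-connected⁻ʳ a b'' f (delete (suc j') (delete (suc i') g))
    (delete-loopless (suc j') (delete (suc i') g) (delete-loopless (suc i') g loopless-g))
    (Connected-cong′ (cong suc size≡) agree connected) ,
  resp-size Φ resp size≡ agree p)
  where
  a : ℕ
  a = suc a'
  size≡ : m ≡ a + b''
  size≡ = trans (suc-injective (trans (sym size) (+-suc a' (suc b'')))) (+-suc a' b'')
  i<′ : i' < suc (suc b'')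
  i<′ = +-cancelˡ-< a i' (suc (suc b'')) (subst (λ t → a + i' < suc t) (sym size) i<)
  j<′ : j' < suc b''
  j<′ = +-cancelˡ-< a j' (suc b'') (subst (a + j' <_) (trans (sym size) (+-suc a' (suc b''))) j<)
  agree : Agree (suc m) (delete (suc (a + j')) (delete (suc (a + i')) (wedge a f g)))
    (wedge a f (delete (suc j') (delete (suc i') g)))
  agree = pointwise⇒Agree (λ x y → trans (delete-wedge-right a f g i' (punchInℕ (suc (a + j')) x)
    (punchInℕ (suc (a + j')) y)) (delete-wedge-right a f (delete (suc i') g) j' x y))

-- The two deleted vertices are adjacent, so they lie on the same side of the wedge.
avoiding-wedge-pair⁻ : ∀ a' b f g Φ → Resp Φ → Loopless f → Loopless g →
  AvoidingPair (a' + b) (wedge (suc a') f g) Φ →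
  AvoidingMove (suc a') f (OnLeft b g Φ) ⊎ AvoidingMove b g (OnRight (suc a') f Φ)
avoiding-wedge-pair⁻ a' b f g Φ resp loopless-f loopless-g P with avoidingPair-view (a' + b)
  (wedge (suc a') f g) Φ P
... | m , size , (i , j , i< , j< , edge , connected , p) with <-or-+ (suc a') i
... | inj₁ i<a with <-or-+ a' j
...   | inj₁ j<a = inj₁ (avoiding-wedge-pairˡ⁻ a' b f g Φ resp loopless-f m size i j i<a j<a edge connected p)
...   | inj₂ (j' , refl) = ⊥-elim (false≢true
    (trans (sym (wedge-no-cross (suc a') f g i (punchInℕ i (a' + j')) i<a
    (≤-trans (s≤s (m≤m+n a' j')) (≤-reflexive (sym (punchInℕ-≥ (≤-trans (≤-pred i<a) (m≤m+n a' j')))))))) edge))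
avoiding-wedge-pair⁻ a' b f g Φ resp loopless-f loopless-g P | m , size ,
  (.(suc a' + i') , j , i< , j< , edge , connected , p) | inj₂ (i' , refl) with <-or-+ (suc a') j
...   | inj₁ j<a = ⊥-elim (false≢true (trans
    (sym (wedge-no-cross′ (suc a') f g (suc a' + i') (punchInℕ (suc a' + i') j) (m≤m+n (suc a') i')
    (subst (_< suc a') (sym (punchInℕ-below (suc a') i' j j<a)) j<a))) edge))
...   | inj₂ (j' , refl) = inj₂ (avoiding-wedge-pairʳ⁻ a' b f g Φ resp loopless-g m size i'
    j' i< j< edge connected p)

avoiding-wedge⁻ : ∀ a' b f g Φ → Resp Φ → Loopless f → Loopless g →
  AvoidingMove (suc a' + b) (wedge (suc a') f g) Φ →
  AvoidingMove (suc a') f (OnLeft b g Φ) ⊎ AvoidingMove b g (OnRight (suc a') f Φ)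
avoiding-wedge⁻ a' b f g Φ resp loopless-f loopless-g (inj₁ s) =
  avoiding-wedge-single⁻ a' b f g Φ resp loopless-f loopless-g s
avoiding-wedge⁻ a' b f g Φ resp loopless-f loopless-g (inj₂ s) =
  avoiding-wedge-pair⁻ a' b f g Φ resp loopless-f loopless-g s

avoiding-wedge⁺ˡ : ∀ a' b f g Φ → Resp Φ → Symmetric f → Symmetric g → Loopless f →
  Loopless g → Connected (suc b) g →
  AvoidingMove (suc a') f (OnLeft b g Φ) → AvoidingMove (suc a' + b) (wedge (suc a') f g) Φ
avoiding-wedge⁺ˡ a' b f g Φ resp sym-f sym-g loopless-f loopless-g connected-g (inj₁ (i , i< , connected , p)) =
  inj₁ (i , <-suc-+ i< ,
    Connected-cong _ _ _ agree (wedge-connected a' b (delete (suc i) f) g (delete-symmetric (suc i) f sym-f) sym-g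
      (delete-loopless (suc i) f loopless-f) loopless-g connected connected-g) ,
    resp (a' + b) (wedge a' (delete (suc i) f) g) (delete (suc i) (wedge (suc a') f g)) agree p)
  where
  agree : Agree (suc (a' + b)) (wedge a' (delete (suc i) f) g) (delete (suc i) (wedge (suc a') f g))
  agree = pointwise⇒Agree (λ x y → sym (delete-wedge-left a' f g i i< x y))
avoiding-wedge⁺ˡ (suc a'') b f g Φ resp sym-f sym-g loopless-f loopless-g connected-g
  (inj₂ (i , j , i< , j< , edge , connected , p)) =
  inj₂ (i , j , <-suc-+ i< , <-suc-+ j< ,
    trans (wedge-left (suc (suc a'')) f g (suc i) (suc (punchInℕ i j)) (s≤s i<)
      (s≤s (punchInℕ-bound {i} j<)) loopless-f) edge ,
    Connected-cong _ _ _ agree (wedge-connected a'' b rest g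
      (delete-symmetric (suc j) _ (delete-symmetric (suc i) f sym-f)) sym-g
      (delete-loopless (suc j) (delete (suc i) f) (delete-loopless (suc i) f loopless-f)) loopless-g
      connected connected-g) ,
    resp (a'' + b) (wedge a'' rest g) _ agree p)
  where
  rest : Adj
  rest = delete (suc j) (delete (suc i) f)
  agree : Agree (suc (a'' + b)) (wedge a'' rest g) (delete (suc j) (delete (suc i) (wedge (suc (suc a'')) f g)))
  agree = pointwise⇒Agree (λ x y → sym (trans
    (delete-wedge-left (suc a'') f g i i< (punchInℕ (suc j) x) (punchInℕ (suc j) y))
    (delete-wedge-left a'' (delete (suc i) f) g j j< x y)))

avoiding-wedge⁺ʳ : ∀ a' b f g Φ → Resp Φ → Symmetric f → Symmetric g → Loopless f → Loopless g →
  Connected (suc (suc a')) f →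
  AvoidingMove b g (OnRight (suc a') f Φ) → AvoidingMove (suc a' + b) (wedge (suc a') f g) Φ
avoiding-wedge⁺ʳ a' (suc b') f g Φ resp sym-f sym-g loopless-f loopless-g connected-f
  (inj₁ (i' , i< , connected , p)) =
  inj₁ (suc a' + i' , +-monoʳ-< (suc a') i< ,
    Connected-cong′ (cong suc (sym (+-suc a' b'))) agree
      (wedge-connected (suc a') b' f (delete (suc i') g) sym-f (delete-symmetric (suc i') g sym-g) loopless-f
      (delete-loopless (suc i') g loopless-g) connected-f connected) ,
    resp-size Φ resp (sym (+-suc a' b')) agree p)
  where
  agree : Agree (suc (suc a' + b')) (wedge (suc a') f (delete (suc i') g))
    (delete (suc (suc a' + i')) (wedge (suc a') f g))
  agree = pointwise⇒Agree (λ x y → sym (delete-wedge-right (suc a') f g i' x y))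
avoiding-wedge⁺ʳ a' (suc (suc b'')) f g Φ resp sym-f sym-g loopless-f loopless-g connected-f
  (inj₂ (i' , j' , i< , j< , edge , connected , p)) =
  inj₂ (avoidingPair-intro (a' + suc (suc b'')) (a' + suc b'') (wedge a f g) Φ (+-suc a' (suc b''))
    (a + i' , a + j' , subst (λ t → a + i' < suc t) (+-suc a' (suc b'')) (+-monoʳ-< a i<) , +-monoʳ-< a j< ,
     trans (trans (cong (λ z → wedge a f g (suc (a + i')) (suc z)) (punchInℕ-+ a i' j'))
       (wedge-right a f g (suc i') (suc (punchInℕ i' j')) loopless-g)) edge ,
     Connected-cong′ (cong suc (sym (+-suc a' b''))) agree
       (wedge-connected a b'' f rest sym-f
       (delete-symmetric (suc j') _ (delete-symmetric (suc i') g sym-g)) loopless-f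
       (delete-loopless (suc j') (delete (suc i') g) (delete-loopless (suc i') g loopless-g))
       connected-f connected) ,
     resp-size Φ resp (sym (+-suc a' b'')) agree p))
  where
  a : ℕ
  a = suc a'
  rest : Adj
  rest = delete (suc j') (delete (suc i') g)
  agree : Agree (suc (a + b'')) (wedge a f rest) (delete (suc (a + j')) (delete (suc (a + i')) (wedge a f g)))
  agree = pointwise⇒Agree (λ x y → sym (trans
    (delete-wedge-right a f g i' (punchInℕ (suc (a + j')) x) (punchInℕ (suc (a + j')) y))
    (delete-wedge-right a f (delete (suc i') g) j' x y)))

cut⇒disconnected : ∀ n g t → 0 < t → t < n → (∀ x y → x < t → t ≤ y → g x y ≡ false) → ¬ Connected n g
cut⇒disconnected n g t 0<t t<n no-cross connected =
  true≢false (trans (sym (walk-preserves (λ z → z <ᵇ t) stays-below (connected 0 t (≤-trans 0<t (<⇒≤ t<n)) t<n)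
                                         (<ᵇ-true 0<t)))
                    (<ᵇ-false {t} {t} ≤-refl))
  where
  stays-below : ∀ w z → (w <ᵇ t) ≡ true → g w z ≡ true → (z <ᵇ t) ≡ true
  stays-below w z w<ᵇt edge with <ᵇ-cases w t | <ᵇ-cases z t
  ... | inj₂ (w≮ᵇt , _) | _              = ⊥-elim (true≢false (trans (sym w<ᵇt) w≮ᵇt))
  ... | inj₁ _          | inj₁ (z<ᵇt , _) = z<ᵇt
  ... | inj₁ (_ , w<t)  | inj₂ (_ , t≤z)  = ⊥-elim (false≢true (trans (sym (no-cross w z w<t t≤z)) edge))

delete-root-and-right-leaf : ∀ a' f g → Loopless f →
  Agree (a' + 1) (delete (suc a' + 0) (delete 0 (wedge (suc a') f g))) (delete 0 f)
delete-root-and-right-leaf a' f g loopless-f x y lx ly rewrite +-identityʳ (suc a') =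
  trans (cong₂ (wedge a f g) (cong suc (punchInℕ-< (subst (x <_) size≡ lx)))
    (cong suc (punchInℕ-< (subst (y <_) size≡ ly))))
        (wedge-left a f g (suc x) (suc y) (s≤s (subst (x <_) size≡ lx)) (s≤s (subst (y <_) size≡ ly)) loopless-f)
  where
  a : ℕ
  a = suc a'
  size≡ : a' + 1 ≡ suc a'
  size≡ = +-comm a' 1

root-wedge⁻ : ∀ a' b' f g Ψ → Resp₀ Ψ → Loopless f → RootMove (suc (a' + suc b')) (wedge (suc a') f g) Ψ →
  ((a' ≡ 0) × Connected (suc b') (delete 0 g) × Ψ (suc b') (delete 0 g)) ⊎
    ((b' ≡ 0) × Connected (suc a') (delete 0 f) × Ψ (suc a') (delete 0 f))
root-wedge⁻ a' b' f g Ψ resp loopless-f (inj₁ (connected , p)) =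
  ⊥-elim (cut⇒disconnected (suc (a' + suc b')) (delete 0 (wedge (suc a') f g)) (suc a') (s≤s z≤n)
    (s≤s (subst (suc a' ≤_) (sym (+-suc a' b')) (s≤s (m≤m+n a' b'))))
    (λ x y lx ly → wedge-no-cross (suc a') f g x y lx ly) connected)
root-wedge⁻ a' b' f g Ψ resp loopless-f (inj₂ (j , j< , edge , connected , p)) with <-or-+ (suc a') j
root-wedge⁻ zero b' f g Ψ resp loopless-f (inj₂ (zero , j< , edge , connected , p)) | inj₁ _ =
  inj₁ (refl , connected , p)
root-wedge⁻ zero b' f g Ψ resp loopless-f (inj₂ (suc j , j< , edge , connected , p)) | inj₁ (s≤s ())
root-wedge⁻ (suc a'') b' f g Ψ resp loopless-f (inj₂ (j , j< , edge , connected , p)) | inj₁ l =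
  ⊥-elim (cut⇒disconnected (suc a'' + suc b') (delete j (delete 0 (wedge (suc (suc a'')) f g))) (suc a'') (s≤s z≤n)
    (s≤s (subst (suc a'' ≤_) (sym (+-suc a'' b')) (s≤s (m≤m+n a'' b'))))
    no-cross connected)
  where
  no-cross : ∀ x y → x < suc a'' → suc a'' ≤ y →
    wedge (suc (suc a'')) f g (suc (punchInℕ j x)) (suc (punchInℕ j y)) ≡ false
  no-cross x y lx ly = wedge-no-cross (suc (suc a'')) f g (punchInℕ j x) (punchInℕ j y) (punchInℕ-bound {j} lx)
    (≤-trans (s≤s ly) (≤-reflexive (sym (punchInℕ-≥ (≤-trans (≤-pred l) ly)))))
root-wedge⁻ a' b' f g Ψ resp loopless-f (inj₂ (.(suc a' + j') , j< , edge , connected , p)) | inj₂ (j' , refl) =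
  through-right b' j< connected p
  where
  a : ℕ
  a = suc a'
  through-right : ∀ b' → a + j' < suc (a' + suc b') →
    Connected (a' + suc b') (delete (a + j') (delete 0 (wedge a f g))) →
    Ψ (a' + suc b') (delete (a + j') (delete 0 (wedge a f g))) →
    ((a' ≡ 0) × Connected (suc b') (delete 0 g) × Ψ (suc b') (delete 0 g)) ⊎
      ((b' ≡ 0) × Connected (suc a') (delete 0 f) × Ψ (suc a') (delete 0 f))
  through-right zero j< connected p = inj₂ (refl , Connected-cong′ size≡ agree connected ,
    resp₀-size Ψ resp size≡ agree p)
    where
    size≡ : a' + 1 ≡ suc a'
    size≡ = +-comm a' 1
    j0 : j' ≡ 0
    j0 = n<1⇒n≡0 (+-cancelˡ-< a j' 1 j<)
    agree : Agree (a' + 1) (delete (a + j') (delete 0 (wedge a f g))) (delete 0 f)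
    agree = subst (λ j → Agree (a' + 1) (delete (a + j) (delete 0 (wedge a f g))) (delete 0 f)) (sym j0)
              (delete-root-and-right-leaf a' f g loopless-f)
  through-right (suc b'') j< connected p = ⊥-elim
    (cut⇒disconnected (a' + suc (suc b'')) (delete (a + j') (delete 0 (wedge a f g))) a (s≤s z≤n)
    (subst (suc (suc a') ≤_) (sym (trans (+-suc a' (suc b'')) (cong suc (+-suc a' b''))))
      (s≤s (s≤s (m≤m+n a' b''))))
    no-cross connected)
    where
    no-cross : ∀ x y → x < a → a ≤ y → wedge a f g (suc (punchInℕ (a + j') x)) (suc (punchInℕ (a + j') y)) ≡ false
    no-cross x y lx ly with <-or-+ a y
    ... | inj₁ l = ⊥-elim (<⇒≱ l ly)
    ... | inj₂ (y' , refl) rewrite punchInℕ-below a j' x lx | punchInℕ-+ a j' y' =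
        wedge-no-cross a f g x (a + punchInℕ j' y') lx (m≤m+n a _)

root-wedge⁺ˡ : ∀ b' f g Ψ → Loopless f → Connected 2 f → Connected (suc b') (delete 0 g) →
  Ψ (suc b') (delete 0 g) →
  RootMove (suc (0 + suc b')) (wedge 1 f g) Ψ
root-wedge⁺ˡ b' f g Ψ loopless-f connected-f connected p =
  inj₂ (0 , s≤s z≤n , connected-2⇒edge f loopless-f connected-f , connected , p)

root-wedge⁺ʳ : ∀ a' f g Ψ → Resp₀ Ψ → Loopless f → Loopless g → Connected 2 g → Connected (suc a') (delete 0 f) →
  Ψ (suc a') (delete 0 f) →
  RootMove (suc (a' + 1)) (wedge (suc a') f g) Ψ
root-wedge⁺ʳ a' f g Ψ resp loopless-f loopless-g connected-g connected p =
  inj₂ (suc a' + 0 , s≤s (+-monoʳ-< a' (s≤s z≤n)) ,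
  trans (wedge-right (suc a') f g 0 1 loopless-g) (connected-2⇒edge g loopless-g connected-g) ,
  Connected-cong′ (sym size≡) (Agree-sym (Agree-cong-size size≡
    (delete-root-and-right-leaf a' f g loopless-f))) connected ,
  resp₀-size Ψ resp (sym size≡) (Agree-sym (Agree-cong-size size≡ (delete-root-and-right-leaf a' f g loopless-f))) p)
  where
  size≡ : a' + 1 ≡ suc a'
  size≡ = +-comm a' 1

pendant-cong : ∀ n f f′ → Agree (suc n) f f′ → Agree (suc (suc n)) (pendant f) (pendant f′)
pendant-cong n f f′ agree zero    zero    _        _        = refl
pendant-cong n f f′ agree zero    (suc y) _        _        = refl
pendant-cong n f f′ agree (suc x) zero    _        _        = refl
pendant-cong n f f′ agree (suc x) (suc y) (s≤s x<) (s≤s y<) = agree x y x< y<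

wedge-congˡ : ∀ a b f f′ g → Agree (suc a) f f′ → Agree (suc (a + b)) (wedge a f g) (wedge a f′ g)
wedge-congˡ a b f f′ g agree zero    zero    _ _ = refl
wedge-congˡ a b f f′ g agree zero    (suc y) _ _ with <ᵇ-cases y a
... | inj₁ (q , y<a) rewrite q = agree 0 (suc y) (s≤s z≤n) (s≤s y<a)
... | inj₂ (q , _)   rewrite q = refl
wedge-congˡ a b f f′ g agree (suc x) zero    _ _ with <ᵇ-cases x a
... | inj₁ (q , x<a) rewrite q = agree (suc x) 0 (s≤s x<a) (s≤s z≤n)
... | inj₂ (q , _)   rewrite q = refl
wedge-congˡ a b f f′ g agree (suc x) (suc y) _ _ with <ᵇ-cases x a | <ᵇ-cases y a
... | inj₁ (q , x<a) | inj₁ (q′ , y<a) rewrite q | q′ = agree (suc x) (suc y) (s≤s x<a) (s≤s y<a)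
... | inj₁ (q , _)   | inj₂ (q′ , _)   rewrite q | q′ = refl
... | inj₂ (q , _)   | inj₁ (q′ , _)   rewrite q | q′ = refl
... | inj₂ (q , _)   | inj₂ (q′ , _)   rewrite q | q′ = refl

wedge-congʳ : ∀ a b f g g′ → Agree (suc b) g g′ → Agree (suc (a + b)) (wedge a f g) (wedge a f g′)
wedge-congʳ a b f g g′ agree zero    zero    _        _        = refl
wedge-congʳ a b f g g′ agree zero    (suc y) _        (s≤s y<) with <ᵇ-cases y a
... | inj₁ (q , _)   rewrite q = refl
... | inj₂ (q , a≤y) rewrite q = agree 0 (suc (y ∸ a)) (s≤s z≤n) (s≤s (∸-<-cancel a≤y y<))
wedge-congʳ a b f g g′ agree (suc x) zero    (s≤s x<) _        with <ᵇ-cases x a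
... | inj₁ (q , _)   rewrite q = refl
... | inj₂ (q , a≤x) rewrite q = agree (suc (x ∸ a)) 0 (s≤s (∸-<-cancel a≤x x<)) (s≤s z≤n)
wedge-congʳ a b f g g′ agree (suc x) (suc y) (s≤s x<) (s≤s y<) with <ᵇ-cases x a | <ᵇ-cases y a
... | inj₁ (q , _)   | inj₁ (q′ , _)   rewrite q | q′ = refl
... | inj₁ (q , _)   | inj₂ (q′ , _)   rewrite q | q′ = refl
... | inj₂ (q , _)   | inj₁ (q′ , _)   rewrite q | q′ = refl
... | inj₂ (q , a≤x) | inj₂ (q′ , a≤y) rewrite q | q′ =
  agree (suc (x ∸ a)) (suc (y ∸ a)) (s≤s (∸-<-cancel a≤x x<)) (s≤s (∸-<-cancel a≤y y<))

wedge-pointʳ : ∀ a f → Loopless f → Agree (suc a) (wedge a f point) f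
wedge-pointʳ a f loopless x y x< y< = wedge-left a f point x y x< y< loopless

wedge-pointˡ : ∀ f g → Loopless g → ∀ x y → wedge 0 f g x y ≡ g x y
wedge-pointˡ f g loopless zero    zero    = sym (loopless 0)
wedge-pointˡ f g loopless zero    (suc y) = refl
wedge-pointˡ f g loopless (suc x) zero    = refl
wedge-pointˡ f g loopless (suc x) (suc y) = refl

Resp-pendant : ∀ Φ → Resp Φ → Resp (λ m g → Φ (suc m) (pendant g))
Resp-pendant Φ resp m g g′ agree = resp (suc m) (pendant g) (pendant g′) (pendant-cong m g g′ agree)

Resp-OnLeft : ∀ b g Φ → Resp Φ → Resp (OnLeft b g Φ)
Resp-OnLeft b g Φ resp m f f′ agree = resp (m + b) (wedge m f g) (wedge m f′ g) (wedge-congˡ m b f f′ g agree)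

Resp-OnRight : ∀ a f Φ → Resp Φ → Resp (OnRight a f Φ)
Resp-OnRight a f Φ resp m g g′ agree = resp (a + m) (wedge a f g) (wedge a f g′) (wedge-congʳ a m f g g′ agree)

path-connected : ∀ l → Connected (suc l) (path l)
path-connected zero    = connected-1 point
path-connected (suc l) = pendant-connected l (path l) (path-symmetric l) (path-connected l)

avoiding-path⁻ : ∀ l Φ → Resp Φ → AvoidingMove (suc l) (path (suc l)) Φ →
  Φ l (path l) ⊎ Σ ℕ (λ l′ → l ≡ suc l′ × Φ l′ (path l′))
avoiding-path⁻ l Φ resp avoiding with avoiding-pendant⁻ l (path l) Φ resp (path-loopless l) avoiding
avoiding-path⁻ zero          Φ resp _ | inj₁ ()
avoiding-path⁻ (suc l)       Φ resp _ | inj₁ shorter with avoiding-path⁻ l _ (Resp-pendant Φ resp) shorter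
... | inj₁ p               = inj₁ p
... | inj₂ (l′ , refl , p) = inj₂ (suc l′ , refl , p)
avoiding-path⁻ zero          Φ resp _ | inj₂ (_ , p)      = inj₁ p
avoiding-path⁻ (suc zero)    Φ resp _ | inj₂ (_ , p)      = inj₂ (0 , refl , p)
avoiding-path⁻ (suc (suc l)) Φ resp _ | inj₂ (s≤s () , _)

avoiding-path⁺₁ : ∀ l Φ → Resp Φ → Φ l (path l) → AvoidingMove (suc l) (path (suc l)) Φ
avoiding-path⁺₁ zero    Φ resp p = avoiding-pendant⁺-P₂ point Φ resp point-loopless p
avoiding-path⁺₁ (suc l) Φ resp p = avoiding-pendant⁺ (suc l) (path (suc l)) Φ resp (path-symmetric (suc l))
  (avoiding-path⁺₁ l _ (Resp-pendant Φ resp) p)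

avoiding-path⁺₂ : ∀ l Φ → Resp Φ → Φ l (path l) → AvoidingMove (suc (suc l)) (path (suc (suc l))) Φ
avoiding-path⁺₂ zero    Φ resp p = avoiding-pendant⁺-P₃ (path 1) Φ resp (path-loopless 1) (path-connected 1) p
avoiding-path⁺₂ (suc l) Φ resp p = avoiding-pendant⁺ (suc (suc l)) (path (suc (suc l))) Φ resp
  (path-symmetric (suc (suc l)))
  (avoiding-path⁺₂ l _ (Resp-pendant Φ resp) p)

𝒢path : ℕ → ℕ
𝒢path l = 𝒢 (suc l) (path l)

PathOptionValue : ℕ → ℕ → Set
PathOptionValue l k = 𝒢path (suc l) ≡ k ⊎ 𝒢path l ≡ k

-- From either end of a path one can only take one or two vertices, so the path on l + 3
-- vertices has exactly the options P(l + 2) and P(l + 1).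
path-option⁻ : ∀ l k → OptionValue (suc (suc l)) (path (suc (suc l))) k → PathOptionValue l k
path-option⁻ l k option with option-split (suc (suc l)) (path (suc (suc l))) k
  (path-symmetric (suc (suc l))) option
... | inj₁ avoiding with avoiding-path⁻ (suc l) (HasValue k) (HasValue-resp k) avoiding
...   | inj₁ value              = inj₁ value
...   | inj₂ (_ , refl , value) = inj₂ value
path-option⁻ l k option | inj₂ root with root-pendant⁻ (suc l) (path (suc l)) (HasValue₀ k) root
...   | inj₁ value       = inj₁ value
...   | inj₂ (_ , value) = inj₂ value

path-option⁺ : ∀ l k → PathOptionValue l k → OptionValue (suc (suc l)) (path (suc (suc l))) k
path-option⁺ l k (inj₁ value) = root⇒option (suc (suc l)) (path (suc (suc l))) k
  (root-pendant⁺-root (suc l) (path (suc l)) (HasValue₀ k) (path-connected (suc l)) value)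
path-option⁺ l k (inj₂ value) = root⇒option (suc (suc l)) (path (suc (suc l))) k
  (root-pendant⁺-pair (suc l) (path (suc l)) (HasValue₀ k) (path-connected l) value)

𝒢≡𝒢path : ∀ n f l → Connected (suc n) f →
  (∀ k → OptionValue n f k → PathOptionValue l k) → (∀ k → PathOptionValue l k → OptionValue n f k) →
  𝒢 (suc n) f ≡ 𝒢path (suc (suc l))
𝒢≡𝒢path n f l connected f⊆path path⊆f =
  𝒢-cong-options n f (suc (suc l)) (path (suc (suc l))) connected (path-connected (suc (suc l)))
    (λ k → path-option⁺ l k ∘ f⊆path k) (λ k → path⊆f k ∘ path-option⁻ l k)

-- spider ks is the subdivided star, centred at 0, whose arms have k + 1 vertices for each k in ks.
armsSize : List ℕ → ℕ
armsSize []       = 0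
armsSize (k ∷ ks) = suc k + armsSize ks

spider : List ℕ → Adj
spider []       = point
spider (k ∷ ks) = wedge (suc k) (path (suc k)) (spider ks)

spider-symmetric : ∀ ks → Symmetric (spider ks)
spider-symmetric []       = point-symmetric
spider-symmetric (k ∷ ks) = wedge-symmetric (suc k) (path (suc k)) (spider ks)
  (path-symmetric (suc k)) (spider-symmetric ks)

spider-loopless : ∀ ks → Loopless (spider ks)
spider-loopless []       = point-loopless
spider-loopless (k ∷ ks) = wedge-loopless (suc k) (path (suc k)) (spider ks)
  (path-loopless (suc k)) (spider-loopless ks)

spider-connected : ∀ ks → Connected (suc (armsSize ks)) (spider ks)
spider-connected []       = connected-1 point
spider-connected (k ∷ ks) =
  wedge-connected (suc k) (armsSize ks) (path (suc k)) (spider ks) (path-symmetric (suc k)) (spider-symmetric ks)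
    (path-loopless (suc k)) (spider-loopless ks) (path-connected (suc k)) (spider-connected ks)

-- The root-avoiding moves of a spider: delete one or two vertices at the end of an arm.
data Shrink : List ℕ → List ℕ → Set where
  drop₁ : ∀ {ks} → Shrink (0 ∷ ks) ks
  cut₁  : ∀ {k ks} → Shrink (suc k ∷ ks) (k ∷ ks)
  drop₂ : ∀ {ks} → Shrink (1 ∷ ks) ks
  cut₂  : ∀ {k ks} → Shrink (suc (suc k) ∷ ks) (k ∷ ks)
  later : ∀ {k ks ks′} → Shrink ks ks′ → Shrink (k ∷ ks) (k ∷ ks′)

shrink-< : ∀ {ks ks′} → Shrink ks ks′ → armsSize ks′ < armsSize ks
shrink-< drop₁             = ≤-refl
shrink-< cut₁              = ≤-refl
shrink-< drop₂             = n≤1+n _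
shrink-< cut₂              = n≤1+n _
shrink-< (later {k} shrink) = +-monoʳ-< (suc k) (shrink-< shrink)

ShrinkWith : (List ℕ → Set) → List ℕ → Set
ShrinkWith P ks = Σ (List ℕ) λ ks′ → Shrink ks ks′ × P ks′

first-arm-gone : ∀ ks Φ → Resp Φ → OnLeft (armsSize ks) (spider ks) Φ 0 point → Φ (armsSize ks) (spider ks)
first-arm-gone ks Φ resp = resp (armsSize ks) _ (spider ks)
  (pointwise⇒Agree (wedge-pointˡ point (spider ks) (spider-loopless ks)))

first-arm-gone⁻¹ : ∀ ks Φ → Resp Φ → Φ (armsSize ks) (spider ks) → OnLeft (armsSize ks) (spider ks) Φ 0 point
first-arm-gone⁻¹ ks Φ resp =
  resp (armsSize ks) (spider ks) _ (pointwise⇒Agree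
    (λ x y → sym (wedge-pointˡ point (spider ks) (spider-loopless ks) x y)))

avoiding-spider⁻ : ∀ ks Φ → Resp Φ → AvoidingMove (armsSize ks) (spider ks) Φ →
  ShrinkWith (λ ks′ → Φ (armsSize ks′) (spider ks′)) ks
avoiding-spider⁻ (k ∷ ks) Φ resp avoiding
  with avoiding-wedge⁻ k (armsSize ks) (path (suc k)) (spider ks) Φ resp (path-loopless (suc k))
    (spider-loopless ks) avoiding
... | inj₂ in-rest with avoiding-spider⁻ ks (OnRight (suc k) (path (suc k)) Φ)
    (Resp-OnRight (suc k) (path (suc k)) Φ resp) in-rest
...   | ks′ , shrink , p = k ∷ ks′ , later shrink , p
avoiding-spider⁻ (k ∷ ks) Φ resp avoiding | inj₁ in-first
  with avoiding-path⁻ k (OnLeft (armsSize ks) (spider ks) Φ)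
    (Resp-OnLeft (armsSize ks) (spider ks) Φ resp) in-first
avoiding-spider⁻ (zero ∷ ks)          Φ resp _ | _ | inj₁ p                 = ks , drop₁ ,
  first-arm-gone ks Φ resp p
avoiding-spider⁻ (suc k ∷ ks)         Φ resp _ | _ | inj₁ p                 = k ∷ ks , cut₁ , p
avoiding-spider⁻ (.1 ∷ ks)            Φ resp _ | _ | inj₂ (zero , refl , p)   = ks , drop₂ ,
  first-arm-gone ks Φ resp p
avoiding-spider⁻ (.(suc (suc l)) ∷ ks) Φ resp _ | _ | inj₂ (suc l , refl , p) = l ∷ ks , cut₂ , p

avoiding-spider⁺ : ∀ ks ks′ Φ → Resp Φ → Shrink ks ks′ → Φ (armsSize ks′) (spider ks′) →
  AvoidingMove (armsSize ks) (spider ks) Φ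
avoiding-spider⁺ (k ∷ ks) ks′ Φ resp shrink p = by-shrink shrink p
  where
  in-first : AvoidingMove (suc k) (path (suc k)) (OnLeft (armsSize ks) (spider ks) Φ) →
    AvoidingMove (armsSize (k ∷ ks)) (spider (k ∷ ks)) Φ
  in-first = avoiding-wedge⁺ˡ k (armsSize ks) (path (suc k)) (spider ks) Φ resp
    (path-symmetric (suc k)) (spider-symmetric ks)
    (path-loopless (suc k)) (spider-loopless ks) (spider-connected ks)
  resp-first : Resp (OnLeft (armsSize ks) (spider ks) Φ)
  resp-first = Resp-OnLeft (armsSize ks) (spider ks) Φ resp
  by-shrink : ∀ {ks′} → Shrink (k ∷ ks) ks′ → Φ (armsSize ks′) (spider ks′) →
    AvoidingMove (armsSize (k ∷ ks)) (spider (k ∷ ks)) Φ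
  by-shrink drop₁          p = in-first (avoiding-path⁺₁ 0 _ resp-first (first-arm-gone⁻¹ ks Φ resp p))
  by-shrink cut₁           p = in-first (avoiding-path⁺₁ _ _ resp-first p)
  by-shrink drop₂          p = in-first (avoiding-path⁺₂ 0 _ resp-first (first-arm-gone⁻¹ ks Φ resp p))
  by-shrink cut₂           p = in-first (avoiding-path⁺₂ _ _ resp-first p)
  by-shrink (later shrink) p =
    avoiding-wedge⁺ʳ k (armsSize ks) (path (suc k)) (spider ks) Φ resp
      (path-symmetric (suc k)) (spider-symmetric ks)
      (path-loopless (suc k)) (spider-loopless ks) (path-connected (suc k))
      (avoiding-spider⁺ ks _ (OnRight (suc k) (path (suc k)) Φ)
        (Resp-OnRight (suc k) (path (suc k)) Φ resp) shrink p)

𝒢spider : List ℕ → ℕ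
𝒢spider ks = 𝒢 (suc (armsSize ks)) (spider ks)

spider-one-arm : ∀ k → Agree (suc (suc k + 0)) (spider (k ∷ [])) (path (suc k))
spider-one-arm k = Agree-cong-size (sym (cong suc (+-identityʳ (suc k))))
  (wedge-pointʳ (suc k) (path (suc k)) (path-loopless (suc k)))

𝒢spider-one-arm : ∀ k → 𝒢spider (k ∷ []) ≡ 𝒢path (suc k)
𝒢spider-one-arm k = 𝒢-cong′ _ _ _ _ (cong suc (+-identityʳ (suc k))) (spider-one-arm k)

spider-one-arm-delete-root : ∀ k → Agree (suc k + 0) (delete 0 (spider (k ∷ []))) (path k)
spider-one-arm-delete-root k = Agree-delete 0 (spider-one-arm k)

spider-one-arm-delete-root-connected : ∀ k → Connected (suc k + 0) (delete 0 (spider (k ∷ [])))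
spider-one-arm-delete-root-connected k =
  Connected-cong′ (sym (+-identityʳ (suc k)))
    (Agree-sym (Agree-cong-size (+-identityʳ (suc k)) (spider-one-arm-delete-root k)))
    (path-connected k)

𝒢spider-one-arm-delete-root : ∀ k → 𝒢 (suc k + 0) (delete 0 (spider (k ∷ []))) ≡ 𝒢path k
𝒢spider-one-arm-delete-root k = 𝒢-cong′ _ _ _ _ (+-identityʳ (suc k)) (spider-one-arm-delete-root k)

wedge-delete-root-disconnected : ∀ a′ b′ f g → ¬ Connected (suc (a′ + suc b′)) (delete 0 (wedge (suc a′) f g))
wedge-delete-root-disconnected a′ b′ f g =
  cut⇒disconnected (suc (a′ + suc b′)) (delete 0 (wedge (suc a′) f g)) (suc a′) (s≤s z≤n)
    (s≤s (subst (suc a′ ≤_) (sym (+-suc a′ b′)) (s≤s (m≤m+n a′ b′))))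
    (λ x y x< y≥ → wedge-no-cross (suc a′) f g x y x< y≥)

-- The spiders with arms of 1 and j + 1 vertices are paths, centred next to an end.
𝒢spider-1-j : ∀ j → 𝒢spider (0 ∷ j ∷ []) ≡ 𝒢path (suc (suc j))
𝒢spider-1-j j = 𝒢≡𝒢path (armsSize (0 ∷ j ∷ [])) (spider (0 ∷ j ∷ [])) j
  (spider-connected (0 ∷ j ∷ [])) classify realise
  where
  classify : ∀ k → OptionValue (armsSize (0 ∷ j ∷ [])) (spider (0 ∷ j ∷ [])) k → PathOptionValue j k
  classify k option with option-split _ (spider (0 ∷ j ∷ [])) k (spider-symmetric (0 ∷ j ∷ [])) option
  ... | inj₁ avoiding with avoiding-spider⁻ (0 ∷ j ∷ []) (HasValue k) (HasValue-resp k) avoiding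
  ...   | .(j ∷ [])      , drop₁ , value                = inj₁ (trans (sym (𝒢spider-one-arm j)) value)
  ...   | .(0 ∷ [])      , later (drop₁ {[]}) , value   = inj₁ (trans (sym (𝒢spider-one-arm 0)) value)
  ...   | .(0 ∷ j′ ∷ []) , later (cut₁ {j′}) , value    = inj₁ (trans (sym (𝒢spider-1-j j′)) value)
  ...   | .(0 ∷ [])      , later (drop₂ {[]}) , value   = inj₂ (trans (sym (𝒢spider-one-arm 0)) value)
  ...   | .(0 ∷ j′ ∷ []) , later (cut₂ {j′}) , value    = inj₂ (trans (sym (𝒢spider-1-j j′)) value)
  ...   | .(0 ∷ _ ∷ _)   , later (later ()) , _
  classify k option | inj₂ root
    with root-wedge⁻ 0 (j + 0) (path 1) (spider (j ∷ [])) (HasValue₀ k) (HasValue₀-resp k) (path-loopless 1) root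
  ... | inj₁ (_ , _ , value) = inj₂ (trans (sym (𝒢spider-one-arm-delete-root j)) value)
  ... | inj₂ (no-rest , _ , value) rewrite +-identityʳ j with no-rest
  ...   | refl = inj₂ value
  realise : ∀ k → PathOptionValue j k → OptionValue (armsSize (0 ∷ j ∷ [])) (spider (0 ∷ j ∷ [])) k
  realise k (inj₁ refl) = avoiding⇒option _ (spider (0 ∷ j ∷ [])) _
    (avoiding-spider⁺ (0 ∷ j ∷ []) (j ∷ []) (HasValue _) (HasValue-resp _) drop₁ (𝒢spider-one-arm j))
  realise k (inj₂ refl) = root⇒option _ (spider (0 ∷ j ∷ [])) _
    (root-wedge⁺ˡ (j + 0) (path 1) (spider (j ∷ [])) (HasValue₀ _) (path-loopless 1) (path-connected 1)
      (spider-one-arm-delete-root-connected j) (𝒢spider-one-arm-delete-root j))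

𝒢spider-j-1 : ∀ j → 𝒢spider (j ∷ 0 ∷ []) ≡ 𝒢path (suc (suc j))
𝒢spider-j-1 j = 𝒢≡𝒢path (armsSize (j ∷ 0 ∷ [])) (spider (j ∷ 0 ∷ [])) j
  (spider-connected (j ∷ 0 ∷ [])) classify realise
  where
  classify : ∀ k → OptionValue (armsSize (j ∷ 0 ∷ [])) (spider (j ∷ 0 ∷ [])) k → PathOptionValue j k
  classify k option with option-split _ (spider (j ∷ 0 ∷ [])) k (spider-symmetric (j ∷ 0 ∷ [])) option
  ... | inj₁ avoiding with avoiding-spider⁻ (j ∷ 0 ∷ []) (HasValue k) (HasValue-resp k) avoiding
  ...   | .(0 ∷ [])      , drop₁ , value       = inj₁ (trans (sym (𝒢spider-one-arm 0)) value)
  ...   | .(j′ ∷ 0 ∷ []) , cut₁ {j′} , value   = inj₁ (trans (sym (𝒢spider-j-1 j′)) value)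
  ...   | .(0 ∷ [])      , drop₂ , value       = inj₂ (trans (sym (𝒢spider-one-arm 0)) value)
  ...   | .(j′ ∷ 0 ∷ []) , cut₂ {j′} , value   = inj₂ (trans (sym (𝒢spider-j-1 j′)) value)
  ...   | .(j ∷ [])      , later drop₁ , value = inj₁ (trans (sym (𝒢spider-one-arm j)) value)
  ...   | .(j ∷ _ ∷ _)   , later (later ()) , _
  classify k option | inj₂ root
    with root-wedge⁻ j 0 (path (suc j)) (spider (0 ∷ [])) (HasValue₀ k) (HasValue₀-resp k)
      (path-loopless (suc j)) root
  ... | inj₂ (_ , _ , value)    = inj₂ value
  ... | inj₁ (refl , _ , value) = inj₂ (trans (sym (𝒢spider-one-arm-delete-root 0)) value)
  realise : ∀ k → PathOptionValue j k → OptionValue (armsSize (j ∷ 0 ∷ [])) (spider (j ∷ 0 ∷ [])) k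
  realise k (inj₁ refl) = avoiding⇒option _ (spider (j ∷ 0 ∷ [])) _
    (avoiding-spider⁺ (j ∷ 0 ∷ []) (j ∷ []) (HasValue _) (HasValue-resp _) (later drop₁) (𝒢spider-one-arm j))
  realise k (inj₂ refl) = root⇒option _ (spider (j ∷ 0 ∷ [])) _
    (root-wedge⁺ʳ j (path (suc j)) (spider (0 ∷ [])) (HasValue₀ _) (HasValue₀-resp _) (path-loopless (suc j))
      (spider-loopless (0 ∷ [])) (spider-connected (0 ∷ [])) (path-connected j) refl)

-- The three smallest spiders (one vertex, P₂, and P₃ centred in the middle) are handled by
-- computation; for all other spiders every move at the centre is worth as much as a shrink.
data LargeSpider : List ℕ → Set where
  one-arm  : ∀ {k} → LargeSpider (suc k ∷ [])
  two-arms : ∀ {k₀ k₁} {ks : List ℕ} → ¬ _≡_ {A = List ℕ} (k₀ ∷ k₁ ∷ ks) (0 ∷ 0 ∷ []) → LargeSpider (k₀ ∷ k₁ ∷ ks)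

large-spider-size : ∀ {ks} → LargeSpider ks → 2 ≤ armsSize ks
large-spider-size (one-arm {k})                = s≤s (s≤s z≤n)
large-spider-size (two-arms {k₀} {k₁} {ks} _) = s≤s (≤-trans (s≤s z≤n) (m≤n+m (suc k₁ + armsSize ks) k₀))

armsSize≡0 : ∀ ks → armsSize ks ≡ 0 → ks ≡ []
armsSize≡0 []       _ = refl
armsSize≡0 (k ∷ ks) ()

shrink-spider-option : ∀ ks ks′ → Shrink ks ks′ → OptionValue (armsSize ks) (spider ks) (𝒢spider ks′)
shrink-spider-option ks ks′ shrink =
  avoiding⇒option (armsSize ks) (spider ks) _ (avoiding-spider⁺ ks ks′ (HasValue _) (HasValue-resp _) shrink refl)

root-move-spider : ∀ ks k → LargeSpider ks → RootMove (armsSize ks) (spider ks) (HasValue₀ k) →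
  ShrinkWith (λ ks′ → 𝒢spider ks′ ≡ k) ks
root-move-spider (suc k₀ ∷ []) k one-arm r
  with root-pendant⁻ (suc k₀) (path (suc k₀)) (HasValue₀ k)
         (subst (λ n → RootMove n (path (suc (suc k₀))) (HasValue₀ k)) (+-identityʳ (suc (suc k₀)))
           (root-resp (suc (suc k₀) + 0) (spider (suc k₀ ∷ [])) (path (suc (suc k₀)))
             (HasValue₀ k) (HasValue₀-resp k)
             (spider-one-arm (suc k₀)) r))
... | inj₁ value = k₀ ∷ [] , cut₁ , trans (𝒢spider-one-arm k₀) value
... | inj₂ (_ , value) with k₀
...   | zero   = [] , drop₂ , value
...   | suc k₂ = k₂ ∷ [] , cut₂ , trans (𝒢spider-one-arm k₂) value
root-move-spider (k₀ ∷ k₁ ∷ ks) k (two-arms ≢P₃) r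
  with root-wedge⁻ k₀ (k₁ + armsSize ks) (path (suc k₀)) (spider (k₁ ∷ ks)) (HasValue₀ k) (HasValue₀-resp k)
         (path-loopless (suc k₀)) r
root-move-spider (k₀ ∷ k₁ ∷ k₂ ∷ ks) k (two-arms ≢P₃) r | inj₁ (_ , connected , _) =
  ⊥-elim (wedge-delete-root-disconnected k₁ (k₂ + armsSize ks) (path (suc k₁)) (spider (k₂ ∷ ks)) connected)
root-move-spider (.0 ∷ zero ∷ []) k (two-arms ≢P₃) r | inj₁ (refl , _ , _) = ⊥-elim (≢P₃ refl)
root-move-spider (.0 ∷ suc zero ∷ []) k (two-arms ≢P₃) r | inj₁ (refl , _ , value) =
  0 ∷ [] , later drop₂ , trans (𝒢spider-one-arm 0) (trans (sym (𝒢spider-one-arm-delete-root 1)) value)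
root-move-spider (.0 ∷ suc (suc k₃) ∷ []) k (two-arms ≢P₃) r | inj₁ (refl , _ , value) =
  0 ∷ k₃ ∷ [] , later cut₂ , trans (𝒢spider-1-j k₃)
    (trans (sym (𝒢spider-one-arm-delete-root (suc (suc k₃)))) value)
root-move-spider (k₀ ∷ k₁ ∷ ks) k (two-arms ≢P₃) r | inj₂ (no-rest , _ , value)
  with m+n≡0⇒m≡0 k₁ no-rest | armsSize≡0 ks (m+n≡0⇒n≡0 k₁ no-rest)
root-move-spider (zero ∷ .0 ∷ .[]) k (two-arms ≢P₃) r | inj₂ _ | refl | refl = ⊥-elim (≢P₃ refl)
root-move-spider (suc zero ∷ .0 ∷ .[]) k (two-arms ≢P₃) r | inj₂ (_ , _ , value) | refl | refl =
  0 ∷ [] , drop₂ , trans (𝒢spider-one-arm 0) value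
root-move-spider (suc (suc k₃) ∷ .0 ∷ .[]) k (two-arms ≢P₃) r | inj₂ (_ , _ , value) | refl | refl =
  k₃ ∷ 0 ∷ [] , cut₂ , trans (𝒢spider-j-1 k₃) value

spider-option⇒shrink : ∀ ks k → LargeSpider ks → OptionValue (armsSize ks) (spider ks) k →
  ShrinkWith (λ ks′ → 𝒢spider ks′ ≡ k) ks
spider-option⇒shrink ks k large option with option-split (armsSize ks) (spider ks) k (spider-symmetric ks) option
... | inj₁ avoiding = avoiding-spider⁻ ks (HasValue k) (HasValue-resp k) avoiding
... | inj₂ root     = root-move-spider ks k large root

-- S -2- ∅ is the spider with a pendant vertex v at the centre, rooted at v.
join∅ : List ℕ → Adj
join∅ ks = pendant (spider ks)

claw : Adj
claw = join∅ (0 ∷ 0 ∷ [])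

joinS11 : List ℕ → Adj
joinS11 ks = wedge (suc (armsSize ks)) (join∅ ks) claw

-- S with one more arm, of 3 vertices (the first being v), and the same with an arm of 2 vertices.
arm3 : List ℕ → Adj
arm3 ks = wedge (suc (armsSize ks)) (join∅ ks) (path 2)

arm2 : List ℕ → Adj
arm2 ks = wedge (suc (armsSize ks)) (join∅ ks) (path 1)

𝒢join∅ : List ℕ → ℕ
𝒢join∅ ks = 𝒢 (suc (suc (armsSize ks))) (join∅ ks)

𝒢arm3 : List ℕ → ℕ
𝒢arm3 ks = 𝒢 (suc (suc (armsSize ks) + 2)) (arm3 ks)

𝒢joinS11 : List ℕ → ℕ
𝒢joinS11 ks = 𝒢 (suc (suc (armsSize ks) + 3)) (joinS11 ks)

join∅-symmetric : ∀ ks → Symmetric (join∅ ks)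
join∅-symmetric ks = pendant-symmetric (spider ks) (spider-symmetric ks)

join∅-loopless : ∀ ks → Loopless (join∅ ks)
join∅-loopless ks = pendant-loopless (spider ks) (spider-loopless ks)

join∅-connected : ∀ ks → Connected (suc (suc (armsSize ks))) (join∅ ks)
join∅-connected ks = pendant-connected (armsSize ks) (spider ks) (spider-symmetric ks) (spider-connected ks)

claw-symmetric : Symmetric claw
claw-symmetric = join∅-symmetric (0 ∷ 0 ∷ [])

claw-loopless : Loopless claw
claw-loopless = join∅-loopless (0 ∷ 0 ∷ [])

claw-connected : Connected 4 claw
claw-connected = join∅-connected (0 ∷ 0 ∷ [])

arm3-symmetric : ∀ ks → Symmetric (arm3 ks)
arm3-symmetric ks = wedge-symmetric (suc (armsSize ks)) (join∅ ks) (path 2) (join∅-symmetric ks) (path-symmetric 2)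

arm3-connected : ∀ ks → Connected (suc (suc (armsSize ks) + 2)) (arm3 ks)
arm3-connected ks =
  wedge-connected (suc (armsSize ks)) 2 (join∅ ks) (path 2) (join∅-symmetric ks) (path-symmetric 2)
    (join∅-loopless ks) (path-loopless 2) (join∅-connected ks) (path-connected 2)

joinS11-symmetric : ∀ ks → Symmetric (joinS11 ks)
joinS11-symmetric ks = wedge-symmetric (suc (armsSize ks)) (join∅ ks) claw (join∅-symmetric ks) claw-symmetric

joinS11-connected : ∀ ks → Connected (suc (suc (armsSize ks) + 3)) (joinS11 ks)
joinS11-connected ks =
  wedge-connected (suc (armsSize ks)) 3 (join∅ ks) claw (join∅-symmetric ks) claw-symmetric
    (join∅-loopless ks) claw-loopless (join∅-connected ks) claw-connected

join∅-avoiding⁺ : ∀ ks ks′ Φ → Resp Φ → Shrink ks ks′ → Φ (suc (armsSize ks′)) (join∅ ks′) →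
  AvoidingMove (suc (armsSize ks)) (join∅ ks) Φ
join∅-avoiding⁺ ks ks′ Φ resp shrink p =
  avoiding-pendant⁺ (armsSize ks) (spider ks) Φ resp (spider-symmetric ks)
    (avoiding-spider⁺ ks ks′ (λ m g → Φ (suc m) (pendant g)) (Resp-pendant Φ resp) shrink p)

join∅-avoiding⁻ : ∀ ks Φ → Resp Φ → 2 ≤ armsSize ks → AvoidingMove (suc (armsSize ks)) (join∅ ks) Φ →
  ShrinkWith (λ ks′ → Φ (suc (armsSize ks′)) (join∅ ks′)) ks
join∅-avoiding⁻ ks Φ resp big avoiding
  with avoiding-pendant⁻ (armsSize ks) (spider ks) Φ resp (spider-loopless ks) avoiding
... | inj₁ in-spider = avoiding-spider⁻ ks (λ m g → Φ (suc m) (pendant g)) (Resp-pendant Φ resp) in-spider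
... | inj₂ (small , _) = ⊥-elim (<⇒≱ (s≤s small) big)

shrink-wedge-option : ∀ ks ks′ b g k → Symmetric g → Loopless g → Connected (suc b) g → Shrink ks ks′ →
  𝒢 (suc (suc (armsSize ks′) + b)) (wedge (suc (armsSize ks′)) (join∅ ks′) g) ≡ k →
  OptionValue (suc (armsSize ks) + b) (wedge (suc (armsSize ks)) (join∅ ks) g) k
shrink-wedge-option ks ks′ b g k symmetric loopless connected shrink value =
  avoiding⇒option _ _ k
    (avoiding-wedge⁺ˡ (armsSize ks) b (join∅ ks) g (HasValue k) (HasValue-resp k) (join∅-symmetric ks) symmetric
      (join∅-loopless ks) loopless connected
      (join∅-avoiding⁺ ks ks′ (OnLeft b g (HasValue k))
        (Resp-OnLeft b g (HasValue k) (HasValue-resp k)) shrink value))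

spider-join∅-option : ∀ ks → OptionValue (suc (armsSize ks)) (join∅ ks) (𝒢spider ks)
spider-join∅-option ks =
  root⇒option _ (join∅ ks) (𝒢spider ks)
    (root-pendant⁺-root (armsSize ks) (spider ks) (HasValue₀ (𝒢spider ks)) (spider-connected ks) refl)

module ExtraArm (ks : List ℕ) (large : LargeSpider ks)
                (IH : ∀ ks′ → Shrink ks ks′ → 𝒢spider ks′ ≡ 𝒢arm3 ks′) where

  n : ℕ
  n = suc (armsSize ks) + 2

  σ : ℕ
  σ = 𝒢spider ks

  below : ∀ k → k < σ → OptionValue n (arm3 ks) k
  below k k<σ with spider-option⇒shrink ks k large (𝒢-below (armsSize ks) (spider ks) (spider-connected ks) k k<σ)
  ... | ks′ , shrink , value =
    shrink-wedge-option ks ks′ 2 (path 2) k (path-symmetric 2) (path-loopless 2) (path-connected 2) shrink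
      (trans (sym (IH ks′ shrink)) value)

  -- By induction, extending a shrink S′ of S gives the value of S′, an option of S.
  no-shrink : ¬ AvoidingMove (suc (armsSize ks)) (join∅ ks) (OnLeft 2 (path 2) (HasValue σ))
  no-shrink avoiding
    with join∅-avoiding⁻ ks (OnLeft 2 (path 2) (HasValue σ))
      (Resp-OnLeft 2 (path 2) (HasValue σ) (HasValue-resp σ))
           (large-spider-size large) avoiding
  ... | ks′ , shrink , value = 𝒢-not-option (armsSize ks) (spider ks)
    (subst (OptionValue (armsSize ks) (spider ks)) (trans (IH ks′ shrink) value)
      (shrink-spider-option ks ks′ shrink))

  -- Shortening the new arm leaves arm2 or join∅, both of which have S itself as an option.
  no-shortening : ¬ AvoidingMove 2 (path 2) (OnRight (suc (armsSize ks)) (join∅ ks) (HasValue σ))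
  no-shortening avoiding
    with avoiding-path⁻ 1 (OnRight (suc (armsSize ks)) (join∅ ks) (HasValue σ))
      (Resp-OnRight (suc (armsSize ks)) (join∅ ks) (HasValue σ) (HasValue-resp σ)) avoiding
  ... | inj₁ arm2-value = option≢𝒢 (suc (armsSize ks) + 1) (arm2 ks) σ
    (root⇒option _ (arm2 ks) σ
      (root-wedge⁺ʳ (armsSize ks) (join∅ ks) (path 1) (HasValue₀ σ) (HasValue₀-resp σ) (join∅-loopless ks)
        (path-loopless 1) (path-connected 1) (spider-connected ks) refl))
    arm2-value
  ... | inj₂ (zero , refl , join∅-value) = option≢𝒢 (suc (armsSize ks)) (join∅ ks) σ (spider-join∅-option ks)
    (trans (sym (𝒢-cong′ _ _ _ _ (cong suc (+-identityʳ (suc (armsSize ks))))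
                  (Agree-cong-size (sym (cong suc (+-identityʳ (suc (armsSize ks)))))
                    (wedge-pointʳ (suc (armsSize ks)) (join∅ ks) (join∅-loopless ks)))))
           join∅-value)

  no-root-move : ¬ RootMove n (arm3 ks) (HasValue₀ σ)
  no-root-move root
    with root-wedge⁻ (armsSize ks) 1 (join∅ ks) (path 2) (HasValue₀ σ) (HasValue₀-resp σ) (join∅-loopless ks) root
  ... | inj₁ (no-arms , _) = <⇒≱ (s≤s z≤n) (subst (2 ≤_) no-arms (large-spider-size large))
  ... | inj₂ (() , _)

  σ-not-option : ¬ OptionValue n (arm3 ks) σ
  σ-not-option option with option-split n (arm3 ks) σ (arm3-symmetric ks) option
  ... | inj₂ root = no-root-move root
  ... | inj₁ avoiding
    with avoiding-wedge⁻ (armsSize ks) 2 (join∅ ks) (path 2) (HasValue σ) (HasValue-resp σ) (join∅-loopless ks)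
           (path-loopless 2) avoiding
  ...   | inj₁ in-join∅ = no-shrink in-join∅
  ...   | inj₂ in-arm   = no-shortening in-arm

  𝒢arm3≡𝒢spider : 𝒢arm3 ks ≡ 𝒢spider ks
  𝒢arm3≡𝒢spider = 𝒢-unique n (arm3 ks) (arm3-connected ks) σ below σ-not-option

𝒢join∅-one-arm : ∀ k → 𝒢join∅ (k ∷ []) ≡ 𝒢path (suc (suc k))
𝒢join∅-one-arm k = 𝒢-cong′ _ _ _ _ (cong (λ z → suc (suc z)) (+-identityʳ (suc k)))
  (pendant-cong (suc k + 0) (spider (k ∷ [])) (path (suc k)) (spider-one-arm k))

-- Deleting the centre c together with v leaves a connected graph only if S is a path starting at c.
centre-pair-move : ∀ ks k → 2 ≤ armsSize ks → Connected (armsSize ks) (delete 0 (spider ks)) →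
  𝒢 (armsSize ks) (delete 0 (spider ks)) ≡ k → ShrinkWith (λ ks′ → 𝒢join∅ ks′ ≡ k) ks
centre-pair-move (zero ∷ []) k (s≤s ()) _ _
centre-pair-move (suc zero ∷ []) k _ _ value =
  [] , drop₂ , trans (sym (𝒢spider-one-arm-delete-root 1)) value
centre-pair-move (suc (suc k₂) ∷ []) k _ _ value =
  k₂ ∷ [] , cut₂ , trans (𝒢join∅-one-arm k₂) (trans (sym (𝒢spider-one-arm-delete-root (suc (suc k₂)))) value)
centre-pair-move (k₀ ∷ k₁ ∷ ks) k _ connected _ =
  ⊥-elim (wedge-delete-root-disconnected k₀ (k₁ + armsSize ks) (path (suc k₀)) (spider (k₁ ∷ ks)) connected)

module JoinS11 (ks : List ℕ) (big : 2 ≤ armsSize ks) (extra-arm : 𝒢spider ks ≡ 𝒢arm3 ks)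
               (IH : ∀ ks′ → Shrink ks ks′ → 𝒢join∅ ks′ ≡ 𝒢joinS11 ks′) where

  n∅ : ℕ
  n∅ = suc (armsSize ks)

  nS11 : ℕ
  nS11 = suc (armsSize ks) + 3

  -- In S -2- S₁,₁, deleting a leaf of S₁,₁ leaves S with an extra arm of 3 vertices.
  claw-leaf≈arm3 : Agree (suc (suc (armsSize ks) + 2))
    (wedge (suc (armsSize ks)) (join∅ ks) (join∅ (0 ∷ []))) (arm3 ks)
  claw-leaf≈arm3 = wedge-congʳ (suc (armsSize ks)) 2 (join∅ ks) (join∅ (0 ∷ [])) (path 2)
    (pendant-cong 1 (spider (0 ∷ [])) (path 1) (spider-one-arm 0))

  arm3-joinS11-option : ∀ k → 𝒢arm3 ks ≡ k → OptionValue nS11 (joinS11 ks) k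
  arm3-joinS11-option k value = avoiding⇒option nS11 (joinS11 ks) k
    (avoiding-wedge⁺ʳ (armsSize ks) 3 (join∅ ks) claw (HasValue k) (HasValue-resp k) (join∅-symmetric ks)
      claw-symmetric (join∅-loopless ks) claw-loopless (join∅-connected ks)
      (join∅-avoiding⁺ (0 ∷ 0 ∷ []) (0 ∷ []) (OnRight (suc (armsSize ks)) (join∅ ks) (HasValue k))
        (Resp-OnRight (suc (armsSize ks)) (join∅ ks) (HasValue k) (HasValue-resp k)) drop₁
        (trans (𝒢-cong _ _ _ claw-leaf≈arm3) value)))

  shrink-joinS11-option : ∀ k → ShrinkWith (λ ks′ → 𝒢join∅ ks′ ≡ k) ks → OptionValue nS11 (joinS11 ks) k
  shrink-joinS11-option k (ks′ , shrink , value) =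
    shrink-wedge-option ks ks′ 3 claw k claw-symmetric claw-loopless claw-connected shrink
      (trans (sym (IH ks′ shrink)) value)

  shrink-join∅-option : ∀ k → ShrinkWith (λ ks′ → 𝒢joinS11 ks′ ≡ k) ks → OptionValue n∅ (join∅ ks) k
  shrink-join∅-option k (ks′ , shrink , value) = avoiding⇒option n∅ (join∅ ks) k
    (join∅-avoiding⁺ ks ks′ (HasValue k) (HasValue-resp k) shrink (trans (IH ks′ shrink) value))

  join∅⊆joinS11 : ∀ k → OptionValue n∅ (join∅ ks) k → OptionValue nS11 (joinS11 ks) k
  join∅⊆joinS11 k option with option-split n∅ (join∅ ks) k (join∅-symmetric ks) option
  ... | inj₁ avoiding = shrink-joinS11-option k (join∅-avoiding⁻ ks (HasValue k) (HasValue-resp k) big avoiding)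
  ... | inj₂ root with root-pendant⁻ (armsSize ks) (spider ks) (HasValue₀ k) root
  ...   | inj₁ spider-value = arm3-joinS11-option k (trans (sym extra-arm) spider-value)
  ...   | inj₂ (connected , value) = shrink-joinS11-option k (centre-pair-move ks k big connected value)

  claw-leaf-option : ∀ k → 𝒢 (suc (suc (armsSize ks) + 2))
    (wedge (suc (armsSize ks)) (join∅ ks) (join∅ (0 ∷ []))) ≡ k →
    OptionValue n∅ (join∅ ks) k
  claw-leaf-option k value =
    subst (OptionValue n∅ (join∅ ks)) (trans extra-arm (trans (sym (𝒢-cong _ _ _ claw-leaf≈arm3)) value))
      (spider-join∅-option ks)

  claw-move : ∀ k → AvoidingMove 3 claw (OnRight (suc (armsSize ks)) (join∅ ks) (HasValue k)) →
    OptionValue n∅ (join∅ ks) k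
  claw-move k avoiding
    with join∅-avoiding⁻ (0 ∷ 0 ∷ []) (OnRight (suc (armsSize ks)) (join∅ ks) (HasValue k))
           (Resp-OnRight (suc (armsSize ks)) (join∅ ks) (HasValue k) (HasValue-resp k)) (s≤s (s≤s z≤n)) avoiding
  ... | .(0 ∷ []) , drop₁ , value         = claw-leaf-option k value
  ... | .(0 ∷ []) , later drop₁ , value   = claw-leaf-option k value
  ... | .(0 ∷ _ ∷ _) , later (later ()) , _

  joinS11⊆join∅ : ∀ k → OptionValue nS11 (joinS11 ks) k → OptionValue n∅ (join∅ ks) k
  joinS11⊆join∅ k option with option-split nS11 (joinS11 ks) k (joinS11-symmetric ks) option
  ... | inj₂ root with root-wedge⁻ (armsSize ks) 2 (join∅ ks) claw (HasValue₀ k) (HasValue₀-resp k)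
      (join∅-loopless ks) root
  ...   | inj₁ (no-arms , _) = ⊥-elim (<⇒≱ (s≤s z≤n) (subst (2 ≤_) no-arms big))
  ...   | inj₂ (() , _)
  joinS11⊆join∅ k option | inj₁ avoiding
    with avoiding-wedge⁻ (armsSize ks) 3 (join∅ ks) claw (HasValue k) (HasValue-resp k) (join∅-loopless ks)
           claw-loopless avoiding
  ... | inj₂ in-claw  = claw-move k in-claw
  ... | inj₁ in-join∅ = shrink-join∅-option k
    (join∅-avoiding⁻ ks (OnLeft 3 claw (HasValue k))
      (Resp-OnLeft 3 claw (HasValue k) (HasValue-resp k)) big in-join∅)

  𝒢join∅≡𝒢joinS11 : 𝒢join∅ ks ≡ 𝒢joinS11 ks
  𝒢join∅≡𝒢joinS11 =
    𝒢-cong-options n∅ (join∅ ks) nS11 (joinS11 ks) (join∅-connected ks)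
      (joinS11-connected ks) join∅⊆joinS11 joinS11⊆join∅

opaque
  unfolding 𝒢

  𝒢spider≡𝒢arm3-point : 𝒢spider [] ≡ 𝒢arm3 []
  𝒢spider≡𝒢arm3-point = refl

  𝒢spider≡𝒢arm3-P₂ : 𝒢spider (0 ∷ []) ≡ 𝒢arm3 (0 ∷ [])
  𝒢spider≡𝒢arm3-P₂ = refl

  𝒢spider≡𝒢arm3-P₃ : 𝒢spider (0 ∷ 0 ∷ []) ≡ 𝒢arm3 (0 ∷ 0 ∷ [])
  𝒢spider≡𝒢arm3-P₃ = refl

  𝒢join∅≡𝒢joinS11-point : 𝒢join∅ [] ≡ 𝒢joinS11 []
  𝒢join∅≡𝒢joinS11-point = refl

  𝒢join∅≡𝒢joinS11-P₂ : 𝒢join∅ (0 ∷ []) ≡ 𝒢joinS11 (0 ∷ [])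
  𝒢join∅≡𝒢joinS11-P₂ = refl

shrink-rec : (P : List ℕ → Set) → (∀ ks → (∀ ks′ → Shrink ks ks′ → P ks′) → P ks) → ∀ ks → P ks
shrink-rec P step = All.wfRec (On.wellFounded armsSize <-wellFounded) 0ℓ P
  (λ ks rec → step ks (λ ks′ shrink → rec (shrink-< shrink)))

𝒢spider≡𝒢arm3 : ∀ ks → 𝒢spider ks ≡ 𝒢arm3 ks
𝒢spider≡𝒢arm3 = shrink-rec (λ ks → 𝒢spider ks ≡ 𝒢arm3 ks) inductive-step
  where
  inductive-step : ∀ ks → (∀ ks′ → Shrink ks ks′ → 𝒢spider ks′ ≡ 𝒢arm3 ks′) → 𝒢spider ks ≡ 𝒢arm3 ks
  inductive-step []                        _  = 𝒢spider≡𝒢arm3-point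
  inductive-step (zero ∷ [])               _  = 𝒢spider≡𝒢arm3-P₂
  inductive-step (zero ∷ zero ∷ [])        _  = 𝒢spider≡𝒢arm3-P₃
  inductive-step (suc k ∷ [])              IH = sym (ExtraArm.𝒢arm3≡𝒢spider (suc k ∷ []) one-arm IH)
  inductive-step (zero ∷ zero ∷ k ∷ ks)   IH =
    sym (ExtraArm.𝒢arm3≡𝒢spider (zero ∷ zero ∷ k ∷ ks) (two-arms λ ()) IH)
  inductive-step (zero ∷ suc k₁ ∷ ks)     IH = sym (ExtraArm.𝒢arm3≡𝒢spider (zero ∷ suc k₁ ∷ ks) (two-arms λ ()) IH)
  inductive-step (suc k₀ ∷ k₁ ∷ ks)       IH = sym (ExtraArm.𝒢arm3≡𝒢spider (suc k₀ ∷ k₁ ∷ ks) (two-arms λ ()) IH)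

𝒢join∅≡𝒢joinS11 : ∀ ks → 𝒢join∅ ks ≡ 𝒢joinS11 ks
𝒢join∅≡𝒢joinS11 = shrink-rec (λ ks → 𝒢join∅ ks ≡ 𝒢joinS11 ks) inductive-step
  where
  inductive-step : ∀ ks → (∀ ks′ → Shrink ks ks′ → 𝒢join∅ ks′ ≡ 𝒢joinS11 ks′) → 𝒢join∅ ks ≡ 𝒢joinS11 ks
  inductive-step []               _  = 𝒢join∅≡𝒢joinS11-point
  inductive-step (zero ∷ [])      _  = 𝒢join∅≡𝒢joinS11-P₂
  inductive-step (suc k ∷ ks)     IH = JoinS11.𝒢join∅≡𝒢joinS11 (suc k ∷ ks) (s≤s (s≤s z≤n))
    (𝒢spider≡𝒢arm3 (suc k ∷ ks)) IH
  inductive-step (zero ∷ k ∷ ks) IH = JoinS11.𝒢join∅≡𝒢joinS11 (zero ∷ k ∷ ks) (s≤s (s≤s z≤n))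
    (𝒢spider≡𝒢arm3 (zero ∷ k ∷ ks)) IH

edgeMatch : Edge → ℕ → ℕ → Bool
edgeMatch e x y = ((proj₁ e ≡ᵇ x) ∧ (proj₂ e ≡ᵇ y)) ∨ ((proj₁ e ≡ᵇ y) ∧ (proj₂ e ≡ᵇ x))

-- fromEdges n es is definitionally toGraph n (edgesAdj es).
edgesAdj : List Edge → Adj
edgesAdj es x y = any (λ e → edgeMatch e x y) es

edgeMatch-true : ∀ p q x y → edgeMatch (p , q) x y ≡ true → (p ≡ x × q ≡ y) ⊎ (p ≡ y × q ≡ x)
edgeMatch-true p q x y e with p ≡ᵇ x in p≡x | q ≡ᵇ y in q≡y
... | true  | true  = inj₁ (≡ᵇ⇒≡′ p≡x , ≡ᵇ⇒≡′ q≡y)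
... | true  | false = inj₂ (≡ᵇ⇒≡′ (∧-conicalˡ _ _ e) , ≡ᵇ⇒≡′ (∧-conicalʳ (p ≡ᵇ y) _ e))
... | false | _     = inj₂ (≡ᵇ⇒≡′ (∧-conicalˡ _ _ e) , ≡ᵇ⇒≡′ (∧-conicalʳ (p ≡ᵇ y) _ e))

edgesAdj-sym : ∀ es x y → edgesAdj es x y ≡ edgesAdj es y x
edgesAdj-sym es x y = any-cong (λ e → edgeMatch e x y) (λ e → edgeMatch e y x) es
  (λ e → ∨-comm ((proj₁ e ≡ᵇ x) ∧ (proj₂ e ≡ᵇ y)) ((proj₁ e ≡ᵇ y) ∧ (proj₂ e ≡ᵇ x)))

edgesAdj-++ : ∀ xs ys x y → edgesAdj (xs ++ ys) x y ≡ (edgesAdj xs x y ∨ edgesAdj ys x y)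
edgesAdj-++ xs ys x y = any-++ (λ e → edgeMatch e x y) xs ys

InArm : ℕ → ℕ → ℕ → ℕ → Set
InArm c s l x = x ≡ c ⊎ (s ≤ x × x < s + l)

InArm-weaken : ∀ {c s l l′ x} → l ≤ l′ → InArm c s l x → InArm c s l′ x
InArm-weaken l≤l′ (inj₁ x≡c) = inj₁ x≡c
InArm-weaken {s = s} l≤l′ (inj₂ (s≤x , x<)) = inj₂ (s≤x , ≤-trans x< (+-monoʳ-≤ s l≤l′))

∉InArm : ∀ {c s l x} → x ≢ c → x < s ⊎ s + l ≤ x → ¬ InArm c s l x
∉InArm x≢c _            (inj₁ x≡c)      = x≢c x≡c
∉InArm x≢c (inj₁ x<s)   (inj₂ (s≤x , _)) = <⇒≱ x<s s≤x
∉InArm x≢c (inj₂ end≤x) (inj₂ (_ , x<))  = <⇒≱ x< end≤x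

pathEdges-support : ∀ c s l x y → c < s → edgesAdj (pathEdges c s l) x y ≡ true →
  InArm c s l x × InArm c s l y × x ≢ y
pathEdges-support c s (suc l) x y c<s e with ∨-true⁻ {edgeMatch (c , s) x y} e
... | inj₁ q with edgeMatch-true c s x y q
...   | inj₁ (refl , refl) = inj₁ refl , inj₂ (≤-refl , m<m+n s (s≤s z≤n)) , λ eq → <-irrefl eq c<s
...   | inj₂ (refl , refl) = inj₂ (≤-refl , m<m+n s (s≤s z≤n)) , inj₁ refl , λ eq → <-irrefl (sym eq) c<s
pathEdges-support c s (suc l) x y c<s e | inj₂ q with pathEdges-support s (suc s) l x y (n<1+n s) q
... | in-x , in-y , x≢y = shift in-x , shift in-y , x≢y
  where
  shift : ∀ {z} → InArm s (suc s) l z → InArm c s (suc l) z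
  shift (inj₁ refl)          = inj₂ (≤-refl , m<m+n s (s≤s z≤n))
  shift {z} (inj₂ (s< , z<)) = inj₂ (<⇒≤ s< , subst (z <_) (sym (+-suc s l)) z<)

armsEdges-support : ∀ c s ls x y → c < s → edgesAdj (armsEdges c s ls) x y ≡ true →
  InArm c s (sum ls) x × InArm c s (sum ls) y × x ≢ y
armsEdges-support c s (l ∷ ls) x y c<s e
  with ∨-true⁻ (trans (sym (edgesAdj-++ (pathEdges c s l) (armsEdges c (s + l) ls) x y)) e)
... | inj₁ q with pathEdges-support c s l x y c<s q
...   | in-x , in-y , x≢y = InArm-weaken (m≤m+n l (sum ls)) in-x , InArm-weaken (m≤m+n l (sum ls)) in-y , x≢y
armsEdges-support c s (l ∷ ls) x y c<s e | inj₂ q with armsEdges-support c (s + l) ls x y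
  (≤-trans c<s (m≤m+n s l)) q
... | in-x , in-y , x≢y = shift in-x , shift in-y , x≢y
  where
  shift : ∀ {z} → InArm c (s + l) (sum ls) z → InArm c s (l + sum ls) z
  shift (inj₁ z≡c)            = inj₁ z≡c
  shift {z} (inj₂ (s+l≤ , z<)) = inj₂ (≤-trans (m≤m+n s l) s+l≤ , subst (z <_) (+-assoc s l (sum ls)) z<)

pendantEdges-support : ∀ c ls x y → 0 < c → edgesAdj ((0 , c) ∷ armsEdges c (suc c) ls) x y ≡ true →
  (x ≡ 0 ⊎ (c ≤ x × x < suc c + sum ls)) × (y ≡ 0 ⊎ (c ≤ y × y < suc c + sum ls)) × x ≢ y
pendantEdges-support c ls x y 0<c e with ∨-true⁻ {edgeMatch (0 , c) x y} e
... | inj₁ q with edgeMatch-true 0 c x y q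
...   | inj₁ (refl , refl) = inj₁ refl , inj₂ (≤-refl , m≤m+n (suc c) (sum ls)) , λ eq → <-irrefl eq 0<c
...   | inj₂ (refl , refl) = inj₂ (≤-refl , m≤m+n (suc c) (sum ls)) , inj₁ refl , λ eq → <-irrefl (sym eq) 0<c
pendantEdges-support c ls x y 0<c e | inj₂ q with armsEdges-support c (suc c) ls x y (n<1+n c) q
... | in-x , in-y , x≢y = widen in-x , widen in-y , x≢y
  where
  widen : ∀ {z} → InArm c (suc c) (sum ls) z → z ≡ 0 ⊎ (c ≤ z × z < suc c + sum ls)
  widen (inj₁ refl)       = inj₂ (≤-refl , m≤m+n (suc c) (sum ls))
  widen (inj₂ (c< , z<)) = inj₂ (<⇒≤ c< , z<)

-- Vertex j of an arm hanging from c and stored from s on: the centre for j = 0, else s + j - 1.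
armVertex : ℕ → ℕ → ℕ → ℕ
armVertex c s zero    = c
armVertex c s (suc j) = s + j

armVertex-suc : ∀ s i → armVertex s (suc s) i ≡ s + i
armVertex-suc s zero    = sym (+-identityʳ s)
armVertex-suc s (suc i) = sym (+-suc s i)

armVertex≢centre : ∀ c s i → c < s → armVertex c s (suc i) ≢ c
armVertex≢centre c s i c<s e = <⇒≱ c<s (≤-trans (m≤m+n s i) (≤-reflexive e))

armVertex-rightIndex : ∀ c s a x → armVertex c s (rightIndex a x) ≡ armVertex c (s + a) x
armVertex-rightIndex c s a zero    = refl
armVertex-rightIndex c s a (suc i) = sym (+-assoc s a i)

armVertex-pos : ∀ c j → 0 < c → 0 < armVertex c (suc c) j
armVertex-pos c zero    0<c = 0<c
armVertex-pos c (suc j) 0<c = s≤s z≤n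

first-edge-misses : ∀ c s j → c < s → ¬ edgeMatch (c , s) c (s + suc j) ≡ true
first-edge-misses c s j c<s q with edgeMatch-true c s c (s + suc j) q
... | inj₁ (_ , s≡) = <-irrefl s≡ (m<m+n s (s≤s z≤n))
... | inj₂ (c≡ , _) = armVertex≢centre c s (suc j) c<s (sym c≡)

pathEdges-centre-misses : ∀ c s l j → c < s → ¬ edgesAdj (pathEdges c s (suc l)) c (s + suc j) ≡ true
pathEdges-centre-misses c s l j c<s e with ∨-true⁻ {edgeMatch (c , s) c (s + suc j)} e
... | inj₁ q    = first-edge-misses c s j c<s q
... | inj₂ rest = ∉InArm {s} {suc s} {l} {c} (λ eq → <-irrefl eq c<s) (inj₁ (≤-trans c<s (n≤1+n s)))
                    (proj₁ (pathEdges-support s (suc s) l c (s + suc j) (n<1+n s) rest))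

pathEdges≈path : ∀ l c s → c < s → ∀ x y → x ≤ l → y ≤ l →
  edgesAdj (pathEdges c s l) (armVertex c s x) (armVertex c s y) ≡ path l x y
pathEdges≈path zero    c s c<s zero zero _ _ = refl
pathEdges≈path (suc l) c s c<s zero zero _ _ =
  ≢true⇒false (λ e → proj₂ (proj₂ (pathEdges-support c s (suc l) c c c<s e)) refl)
pathEdges≈path (suc l) c s c<s zero (suc zero) _ _ rewrite +-identityʳ s | ≡ᵇ-refl c | ≡ᵇ-refl s = refl
pathEdges≈path (suc l) c s c<s zero (suc (suc j)) _ _ = ≢true⇒false (pathEdges-centre-misses c s l j c<s)
pathEdges≈path (suc l) c s c<s (suc zero) zero _ _ rewrite +-identityʳ s | ≡ᵇ-refl c | ≡ᵇ-refl s =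
  ∨-trueˡ (∨-trueʳ {(c ≡ᵇ s) ∧ (s ≡ᵇ c)} refl)
pathEdges≈path (suc l) c s c<s (suc (suc i)) zero _ _ =
  ≢true⇒false (pathEdges-centre-misses c s l i c<s ∘ subst (_≡ true)
    (edgesAdj-sym (pathEdges c s (suc l)) (s + suc i) c))
pathEdges≈path (suc l) c s c<s (suc i) (suc j) (s≤s i≤l) (s≤s j≤l) =
  trans (cong₂ _∨_ first-edge-absent
          (trans (cong₂ (edgesAdj (pathEdges s (suc s) l)) (sym (armVertex-suc s i)) (sym (armVertex-suc s j)))
                 (pathEdges≈path l s (suc s) (n<1+n s) i j i≤l j≤l)))
        refl
  where
  first-edge-absent : edgeMatch (c , s) (s + i) (s + j) ≡ false
  first-edge-absent = ≢true⇒false λ q → case edgeMatch-true c s (s + i) (s + j) q of λ where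
    (inj₁ (c≡ , _)) → <⇒≱ c<s (≤-trans (m≤m+n s i) (≤-reflexive (sym c≡)))
    (inj₂ (c≡ , _)) → <⇒≱ c<s (≤-trans (m≤m+n s j) (≤-reflexive (sym c≡)))

data WedgeView (a : ℕ) : ℕ → Set where
  root  : WedgeView a 0
  left  : ∀ i → i < a → WedgeView a (suc i)
  right : ∀ j → WedgeView a (suc (a + j))

wedgeView : ∀ a x → WedgeView a x
wedgeView a zero = root
wedgeView a (suc x) with <-or-+ a x
... | inj₁ x<a        = left x x<a
... | inj₂ (j , refl) = right j

edges-++≈wedge : ∀ a b f g (ρ : ℕ → ℕ) E₁ E₂ → Loopless f → Loopless g →
  (∀ x y → x < suc a → y < suc a → edgesAdj E₁ (ρ x) (ρ y) ≡ f x y) →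
  (∀ x y → x < suc b → y < suc b → edgesAdj E₂ (ρ (rightIndex a x)) (ρ (rightIndex a y)) ≡ g x y) →
  (∀ j z → edgesAdj E₁ (ρ (suc (a + j))) z ≡ false) →
  (∀ i z → i < a → edgesAdj E₂ (ρ (suc i)) z ≡ false) →
  ∀ x y → x < suc (a + b) → y < suc (a + b) → edgesAdj (E₁ ++ E₂) (ρ x) (ρ y) ≡ wedge a f g x y
edges-++≈wedge a b f g ρ E₁ E₂ loopless-f loopless-g E₁≈f E₂≈g E₁-avoids E₂-avoids x y =
  by-cases (wedgeView a x) (wedgeView a y)
  where
  z<s : ∀ {n} → 0 < suc n
  z<s = s≤s z≤n
  right< : ∀ {j} → suc (a + j) < suc (a + b) → suc j < suc b
  right< l = s≤s (+-cancelˡ-< a _ _ (≤-pred l))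
  E₁-avoids′ : ∀ j z → edgesAdj E₁ z (ρ (suc (a + j))) ≡ false
  E₁-avoids′ j z = trans (edgesAdj-sym E₁ z _) (E₁-avoids j z)
  E₂-avoids′ : ∀ i z → i < a → edgesAdj E₂ z (ρ (suc i)) ≡ false
  E₂-avoids′ i z i< = trans (edgesAdj-sym E₂ z _) (E₂-avoids i z i<)
  on-left : ∀ x y → x < suc a → y < suc a → edgesAdj E₂ (ρ x) (ρ y) ≡ false →
    edgesAdj (E₁ ++ E₂) (ρ x) (ρ y) ≡ wedge a f g x y
  on-left x y x< y< absent =
    trans (edgesAdj-++ E₁ E₂ _ _) (trans (cong₂ _∨_ (E₁≈f x y x< y<) absent)
      (trans (∨-identityʳ _) (sym (wedge-left a f g x y x< y< loopless-f))))
  on-right : ∀ x y → x < suc b → y < suc b → edgesAdj E₁ (ρ (rightIndex a x)) (ρ (rightIndex a y)) ≡ false →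
    edgesAdj (E₁ ++ E₂) (ρ (rightIndex a x)) (ρ (rightIndex a y)) ≡ wedge a f g (rightIndex a x) (rightIndex a y)
  on-right x y x< y< absent =
    trans (edgesAdj-++ E₁ E₂ _ _) (trans (cong₂ _∨_ absent (E₂≈g x y x< y<))
      (sym (wedge-right a f g x y loopless-g)))
  by-cases : ∀ {x y} → WedgeView a x → WedgeView a y → x < suc (a + b) → y < suc (a + b) →
    edgesAdj (E₁ ++ E₂) (ρ x) (ρ y) ≡ wedge a f g x y
  by-cases root        root        _  _  = on-left 0 0 z<s z<s (trans (E₂≈g 0 0 z<s z<s) (loopless-g 0))
  by-cases root        (left j j<) _  _  = on-left 0 (suc j) z<s (s≤s j<) (E₂-avoids′ j _ j<)
  by-cases (left i i<) root        _  _  = on-left (suc i) 0 (s≤s i<) z<s (E₂-avoids i _ i<)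
  by-cases (left i i<) (left j j<) _  _  = on-left (suc i) (suc j) (s≤s i<) (s≤s j<) (E₂-avoids i _ i<)
  by-cases root        (right j)   _  y< = on-right 0 (suc j) z<s (right< y<) (E₁-avoids′ j _)
  by-cases (right i)   root        x< _  = on-right (suc i) 0 (right< x<) z<s (E₁-avoids i _)
  by-cases (right i)   (right j)   x< y< = on-right (suc i) (suc j) (right< x<) (right< y<) (E₁-avoids i _)
  by-cases (left i i<) (right j)   _  _  =
    trans (edgesAdj-++ E₁ E₂ _ _) (trans (cong₂ _∨_ (E₁-avoids′ j _) (E₂-avoids i _ i<))
      (sym (wedge-no-cross a f g i (a + j) i< (m≤m+n a j))))
  by-cases (right i)   (left j j<) _  _  =
    trans (edgesAdj-++ E₁ E₂ _ _) (trans (cong₂ _∨_ (E₁-avoids i _) (E₂-avoids′ j _ j<))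
      (sym (wedge-no-cross′ a f g (a + i) j (m≤m+n a i) j<)))

armsEdges≈spider : ∀ ks c s → c < s → ∀ x y → x < suc (armsSize ks) → y < suc (armsSize ks) →
  edgesAdj (armsEdges c s (map suc ks)) (armVertex c s x) (armVertex c s y) ≡ spider ks x y
armsEdges≈spider []       c s c<s x y x< y< = refl
armsEdges≈spider (k ∷ ks) c s c<s =
  edges-++≈wedge (suc k) (armsSize ks) (path (suc k)) (spider ks) (armVertex c s) first-arm other-arms
    (path-loopless (suc k)) (spider-loopless ks)
    (λ x y x< y< → pathEdges≈path (suc k) c s c<s x y (≤-pred x<) (≤-pred y<))
    (λ x y x< y< → trans (cong₂ (edgesAdj other-arms) (armVertex-rightIndex c s (suc k) x)
      (armVertex-rightIndex c s (suc k) y))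
                         (armsEdges≈spider ks c (s + suc k) c<s′ x y x< y<))
    (λ j z → ≢true⇒false λ e → ∉InArm (armVertex≢centre c s (suc k + j) c<s) (inj₂ (+-monoʳ-≤ s (m≤m+n (suc k) j)))
                                   (proj₁ (pathEdges-support c s (suc k) _ z c<s e)))
    (λ i z i< → ≢true⇒false λ e → ∉InArm (armVertex≢centre c s i c<s) (inj₁ (+-monoʳ-< s i<))
                                      (proj₁ (armsEdges-support c (s + suc k) (map suc ks) _ z c<s′ e)))
  where
  first-arm other-arms : List Edge
  first-arm  = pathEdges c s (suc k)
  other-arms = armsEdges c (s + suc k) (map suc ks)
  c<s′ : c < s + suc k
  c<s′ = ≤-trans c<s (m≤m+n s (suc k))

armsEdges-avoid-0 : ∀ c ls z → 0 < c → ¬ edgesAdj (armsEdges c (suc c) ls) 0 z ≡ true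
armsEdges-avoid-0 c ls z 0<c e =
  ∉InArm (λ eq → <-irrefl eq 0<c) (inj₁ (s≤s z≤n)) (proj₁ (armsEdges-support c (suc c) ls 0 z (n<1+n c) e))

-- The new root sits at 0 and the centre c of the spider keeps its place.
pendantVertex : ℕ → ℕ → ℕ
pendantVertex c zero    = 0
pendantVertex c (suc j) = armVertex c (suc c) j

pendantEdges≈join∅ : ∀ ks c → 0 < c → ∀ x y → x < suc (suc (armsSize ks)) → y < suc (suc (armsSize ks)) →
  edgesAdj ((0 , c) ∷ armsEdges c (suc c) (map suc ks)) (pendantVertex c x) (pendantVertex c y) ≡ join∅ ks x y
pendantEdges≈join∅ ks c 0<c zero zero _ _ =
  ≢true⇒false λ e → proj₂ (proj₂ (pendantEdges-support c (map suc ks) 0 0 0<c e)) refl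
pendantEdges≈join∅ ks c 0<c zero (suc zero) _ _ = ∨-trueˡ (∨-trueˡ (cong₂ _∧_ refl (≡ᵇ-refl c)))
pendantEdges≈join∅ ks c 0<c zero (suc (suc j)) _ _ =
  cong₂ _∨_ (≢true⇒false λ q → case edgeMatch-true 0 c 0 (suc c + j) q of λ where
                (inj₁ (_ , c≡)) → <-irrefl c≡ (≤-trans (n<1+n c) (m≤m+n (suc c) j))
                (inj₂ (0≡ , _)) → 0≢1+n 0≡)
            (≢true⇒false (armsEdges-avoid-0 c (map suc ks) _ 0<c))
pendantEdges≈join∅ ks c 0<c (suc zero) zero _ _ =
  ∨-trueˡ (∨-trueʳ {(0 ≡ᵇ c) ∧ (c ≡ᵇ 0)} (cong₂ _∧_ refl (≡ᵇ-refl c)))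
pendantEdges≈join∅ ks c 0<c (suc (suc i)) zero x< _ =
  trans (edgesAdj-sym ((0 , c) ∷ armsEdges c (suc c) (map suc ks)) (pendantVertex c (suc (suc i))) 0)
        (pendantEdges≈join∅ ks c 0<c zero (suc (suc i)) (s≤s z≤n) x<)
pendantEdges≈join∅ ks c 0<c (suc i) (suc j) (s≤s x<) (s≤s y<) =
  trans (cong₂ _∨_ root-edge-absent refl) (armsEdges≈spider ks c (suc c) (n<1+n c) i j x< y<)
  where
  root-edge-absent : edgeMatch (0 , c) (armVertex c (suc c) i) (armVertex c (suc c) j) ≡ false
  root-edge-absent = ≢true⇒false λ q → case edgeMatch-true 0 c _ _ q of λ where
    (inj₁ (0≡ , _)) → <-irrefl 0≡ (armVertex-pos c i 0<c)
    (inj₂ (0≡ , _)) → <-irrefl 0≡ (armVertex-pos c j 0<c)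

sum-map-suc : ∀ ks → sum (map suc ks) ≡ armsSize ks
sum-map-suc []       = refl
sum-map-suc (k ∷ ks) = cong (suc k +_) (sum-map-suc ks)

pendantVertex-1 : ∀ x → pendantVertex 1 x ≡ x
pendantVertex-1 zero          = refl
pendantVertex-1 (suc zero)    = refl
pendantVertex-1 (suc (suc j)) = refl

join∅Edges : List ℕ → List Edge
join∅Edges ks = (0 , 1) ∷ armsEdges 1 2 (map suc ks)

join∅Edges≈join∅ : ∀ ks x y → x < suc (suc (armsSize ks)) → y < suc (suc (armsSize ks)) →
  edgesAdj (join∅Edges ks) x y ≡ join∅ ks x y
join∅Edges≈join∅ ks x y x< y< =
  trans (cong₂ (edgesAdj (join∅Edges ks)) (sym (pendantVertex-1 x)) (sym (pendantVertex-1 y)))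
    (pendantEdges≈join∅ ks 1 (s≤s z≤n) x y x< y<)

-- Vertex numbering of Defs: v = 0, the centre of S = 1, the centre of S₁,₁ = s11Centre ks.
s11Centre : List ℕ → ℕ
s11Centre ks = suc (suc (sum (map suc ks)))

s11Edges : ℕ → List Edge
s11Edges c = (0 , c) ∷ armsEdges c (suc c) (1 ∷ 1 ∷ [])

s11Centre≡ : ∀ ks → s11Centre ks ≡ suc (suc (armsSize ks))
s11Centre≡ ks = cong (λ z → suc (suc z)) (sum-map-suc ks)

pendantVertex-s11Centre : ∀ ks x → pendantVertex (s11Centre ks) x ≡ rightIndex (suc (armsSize ks)) x
pendantVertex-s11Centre ks zero          = refl
pendantVertex-s11Centre ks (suc zero)    = trans (s11Centre≡ ks) (cong suc (sym (+-identityʳ (suc (armsSize ks)))))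
pendantVertex-s11Centre ks (suc (suc j)) =
  trans (cong (λ z → suc z + j) (s11Centre≡ ks)) (cong suc (sym (+-suc (suc (armsSize ks)) j)))

joinS11Edges≈joinS11 : ∀ ks → Agree (suc (suc (armsSize ks) + 3))
  (edgesAdj (join∅Edges ks ++ s11Edges (s11Centre ks))) (joinS11 ks)
joinS11Edges≈joinS11 ks =
  edges-++≈wedge (suc (armsSize ks)) 3 (join∅ ks) claw id (join∅Edges ks) (s11Edges c′)
    (join∅-loopless ks) claw-loopless
    (join∅Edges≈join∅ ks)
    (λ x y x< y< → trans (cong₂ (edgesAdj (s11Edges c′)) (sym (pendantVertex-s11Centre ks x))
      (sym (pendantVertex-s11Centre ks y)))
                         (pendantEdges≈join∅ (0 ∷ 0 ∷ []) c′ (s≤s z≤n) x y x< y<))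
    (λ j z → ≢true⇒false λ e → case proj₁ (pendantEdges-support 1 (map suc ks) _ z (s≤s z≤n) e) of λ where
       (inj₂ (_ , j<)) → <⇒≱ j< (≤-trans (≤-reflexive (s11Centre≡ ks)) (s≤s (m≤m+n (suc (armsSize ks)) j))))
    (λ i z i< → ≢true⇒false λ e → case proj₁ (pendantEdges-support c′ (1 ∷ 1 ∷ [])
      (suc i) z (s≤s z≤n) e) of λ where
       (inj₂ (c′≤ , _)) → <⇒≱ (s≤s i<) (≤-trans (≤-reflexive (sym (s11Centre≡ ks))) c′≤))
  where
  c′ : ℕ
  c′ = s11Centre ks

join2-∅-edges : ∀ ks → join2 (just (map suc ks)) nothing ≡ toGraph (join2Size (just (map suc ks)) nothing)
  (edgesAdj (join∅Edges ks ++ []))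
join2-∅-edges ks = refl

join2-S11-edges : ∀ ks →
  join2 (just (map suc ks)) S11 ≡ toGraph (join2Size (just (map suc ks)) S11)
    (edgesAdj (join∅Edges ks ++ s11Edges (s11Centre ks)))
join2-S11-edges ks = refl

join∅Edges++[]≈join∅ : ∀ ks → Agree (suc (suc (armsSize ks))) (edgesAdj (join∅Edges ks ++ [])) (join∅ ks)
join∅Edges++[]≈join∅ ks x y x< y< =
  trans (edgesAdj-++ (join∅Edges ks) [] x y) (trans (∨-identityʳ _) (join∅Edges≈join∅ ks x y x< y<))

join2Size-∅ : ∀ ks → join2Size (just (map suc ks)) nothing ≡ suc (suc (armsSize ks))
join2Size-∅ ks = cong suc (trans (+-identityʳ _) (cong suc (sum-map-suc ks)))

join2Size-S11 : ∀ ks → join2Size (just (map suc ks)) S11 ≡ suc (suc (armsSize ks) + 3)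
join2Size-S11 ks = cong (λ z → suc (suc z + 3)) (sum-map-suc ks)

grundy-join2-∅ : ∀ ks → grundy (join2Size (just (map suc ks)) nothing)
  (join2 (just (map suc ks)) nothing) ≡ 𝒢join∅ ks
grundy-join2-∅ ks =
  trans (cong (grundy (join2Size (just (map suc ks)) nothing)) (join2-∅-edges ks))
    (trans (sym (𝒢-def (join2Size (just (map suc ks)) nothing) (edgesAdj (join∅Edges ks ++ []))))
      (𝒢-cong′ _ _ _ _ (join2Size-∅ ks) (Agree-cong-size (sym (join2Size-∅ ks)) (join∅Edges++[]≈join∅ ks))))

grundy-join2-S11 : ∀ ks → grundy (join2Size (just (map suc ks)) S11) (join2 (just (map suc ks)) S11) ≡ 𝒢joinS11 ks
grundy-join2-S11 ks =
  trans (cong (grundy (join2Size (just (map suc ks)) S11)) (join2-S11-edges ks))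
    (trans (sym (𝒢-def (join2Size (just (map suc ks)) S11) (edgesAdj (join∅Edges ks ++ s11Edges (s11Centre ks)))))
      (𝒢-cong′ _ _ _ _ (join2Size-S11 ks) (Agree-cong-size (sym (join2Size-S11 ks)) (joinS11Edges≈joinS11 ks))))

JoinValuesAgree : List ℕ → Set
JoinValuesAgree ls = grundy (join2Size (just ls) nothing) (join2 (just ls) nothing)
                       ≡ grundy (join2Size (just ls) S11) (join2 (just ls) S11)

spider-join-values : ∀ ks → JoinValuesAgree (map suc ks)
spider-join-values ks = trans (grundy-join2-∅ ks) (trans (𝒢join∅≡𝒢joinS11 ks) (sym (grundy-join2-S11 ks)))

positive⇒map-suc : ∀ ls → All (1 ≤_) ls → Σ (List ℕ) λ ks → ls ≡ map suc ks
positive⇒map-suc []           []               = [] , refl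
positive⇒map-suc (suc k ∷ ls) (s≤s z≤n ∷ pos) with positive⇒map-suc ls pos
... | ks , refl = k ∷ ks , refl

star-join-values : ∀ ls → All (1 ≤_) ls → JoinValuesAgree ls
star-join-values ls positive = from-spider (positive⇒map-suc ls positive)
  where
  from-spider : Σ (List ℕ) (λ ks → ls ≡ map suc ks) → JoinValuesAgree ls
  from-spider (ks , ls≡) = subst JoinValuesAgree (sym ls≡) (spider-join-values ks)

lemma5 : (S : Maybe (List ℕ)) → IsStarOrEmpty S →
         grundy (join2Size S nothing) (join2 S nothing)
           ≡ grundy (join2Size S S11) (join2 S S11)
lemma5 nothing          empty                  = refl
lemma5 (just (l ∷ ls)) (star .l .ls positive) = star-join-values (l ∷ ls) positive
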